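{- Let $(G,\mathcal{R})$ be a framed directed graph. Then $p\mapsto\mathcal{I}(p)$ is a bijection from elementary routes of $(G,\mathcal{R})$ to vertices of $\mathcal F_1(G)$, and $B\mapsto\mathcal{I}(B)$ is a bijection from self-compatible elementary bands of $(G,\mathcal{R})$ to the extremal rays of $\mathcal F_1(G)$.
   Context: $G$ is a finite directed graph (edge set $E$); each edge $e$ has tail $t(e)$ and head $h(e)$; $\mathrm{in}(v)$, $\mathrm{out}(v)$ are the incoming/outgoing edges at $v$. A vertex is a source if $\mathrm{in}(v)=\emptyset$, a sink if $\mathrm{out}(v)=\emptyset$, internal otherwise. A flow is $F:E\to\mathbb R$ with $\sum_{e\in\mathrm{in}(v)}F(e)=\sum_{e\in\mathrm{out}(v)}F(e)$ at every internal $v$; $\mathcal F_1(G)$ is the set of nonnegative flows with $\sum_{e \text{ out of a source}}F(e)=1$. A framing $\mathcal R$ assigns, at each internal vertex $v$, a linear order to $\mathrm{in}(v)$ and one to $\mathrm{out}(v)$. A route is a directed path from a source to a sink; a band is a directed closed walk $e_1\cdots e_m$ ($h(e_m)=t(e_1)$) not a power of a shorter one, up to cyclic rotation; subpaths of a band are subpaths of its powers; a trail is a route or band. $\mathcal I(p)\in\mathbb R^E$ counts the number of traversals of each edge. An incompatibility is a pair $(e_1Rf_2,e_2Rf_1)$ where $R$ is a (possibly empty) directed path from internal $v$ to internal $w$, $e_1<e_2$ in $\mathrm{in}(v)$ and $f_1<f_2$ in $\mathrm{out}(w)$. Trails $p,q$ are incompatible if there are subpaths $p'$ of $p$ and $q'$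 of $q$ with $(p',q')$ an incompatibility; otherwise compatible; self-compatible means compatible with itself. A route or band is simple if it visits no vertex twice. An elementary route is a self-compatible simple route; an elementary band is a simple band. Extremal rays of a pointed polyhedron are the elements (up to positive scaling) of a minimal generating set of its recession cone.
   Formalization: Flows take values in ℚ rather than ℝ, so the vertices and extremal rays of $\mathcal F_1(G)$ are determined among rational flows. -}

module Defs where

open import Data.Nat using (ℕ; zero; suc; _≥_)
open import Data.Fin using (Fin; zero; suc; _≟_)
open import Data.Bool using (Bool; true; false; if_then_else_; not)
open import Data.List using (List; []; _∷_; _++_; map; concat; replicate; length; allFin)
open import Data.Bool.ListAction using (any)
open import Data.List.Relation.Unary.Linked using (Linked)
open import Data.List.Relation.Unary.Unique.Propositional using (Unique)
open import Data.Product using (Σ; ∃; ∃-syntax; _×_; _,_)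
open import Data.Sum using (_⊎_)
open import Data.Integer using (+_)
open import Data.Rational using (ℚ; 0ℚ; 1ℚ; _+_; _*_; _-_; _≤_; _<_; _/_)
open import Relation.Nullary using (¬_; does)
open import Relation.Binary.PropositionalEquality using (_≡_; _≢_)

record Graph : Set where
  field
    nV   : ℕ
    nE   : ℕ
    tail : Fin nE → Fin nV
    head : Fin nE → Fin nV

module _ (G : Graph) where
  open Graph G

  V E : Set
  V = Fin nV
  E = Fin nE

  IsSource : V → Set
  IsSource v = ∀ (e : E) → head e ≢ v

  IsSink : V → Set
  IsSink v = ∀ (e : E) → tail e ≢ v

  IsInternal : V → Set
  IsInternal v = ¬ IsSource v × ¬ IsSink v

  isSourceᵇ : V → Bool
  isSourceᵇ v = not (any (λ e → does (head e ≟ v)) (allFin nE))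

  -- A framing: at every internal vertex v a strict linear order on in(v)
  -- and one on out(v).  inLt e f means: e,f ∈ in(v) with v internal and e < f.
  record Framing : Set₁ where
    field
      inLt  : E → E → Set
      outLt : E → E → Set
      inLt-same       : ∀ {e f} → inLt e f → head e ≡ head f
      inLt-internal   : ∀ {e f} → inLt e f → IsInternal (head e)
      inLt-irrefl     : ∀ {e} → ¬ inLt e e
      inLt-trans      : ∀ {e f g} → inLt e f → inLt f g → inLt e g
      inLt-total      : ∀ e f → head e ≡ head f → IsInternal (head e) →
                        e ≢ f → inLt e f ⊎ inLt f e
      outLt-same      : ∀ {e f} → outLt e f → tail e ≡ tail f
      outLt-internal  : ∀ {e f} → outLt e f → IsInternal (tail e)
      outLt-irrefl    : ∀ {e} → ¬ outLt e e
      outLt-trans     : ∀ {e f g} → outLt e f → outLt f g → outLt e g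
      outLt-total     : ∀ e f → tail e ≡ tail f → IsInternal (tail e) →
                        e ≢ f → outLt e f ⊎ outLt f e

  Consec : E → E → Set
  Consec e f = head e ≡ tail f

  IsWalk : List E → Set
  IsWalk = Linked Consec

  lastOf : E → List E → E
  lastOf e []       = e
  lastOf e (f ∷ fs) = lastOf f fs

  IsRoute : List E → Set
  IsRoute p = Σ E λ e → Σ (List E) λ es →
    (p ≡ e ∷ es) × IsWalk p × IsSource (tail e) × IsSink (head (lastOf e es))

  -- band: closed walk, not a power of a shorter one (rotation handled separately)
  IsBand : List E → Set
  IsBand b = Σ E λ e → Σ (List E) λ es →
    (b ≡ e ∷ es) × IsWalk b × (head (lastOf e es) ≡ tail e) ×
    ¬ (Σ (List E) λ q → Σ ℕ λ k → (k ≥ 2) × (b ≡ concat (replicate k q)))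

  RotEq : List E → List E → Set
  RotEq b b' = Σ (List E) λ xs → Σ (List E) λ ys → (b ≡ xs ++ ys) × (b' ≡ ys ++ xs)

  SimpleRoute : List E → Set
  SimpleRoute [] = Unique ([] {A = V})
  SimpleRoute (e ∷ es) = Unique (tail e ∷ map head (e ∷ es))

  SimpleBand : List E → Set
  SimpleBand b = Unique (map tail b)

  data Trail : Set where
    route : List E → Trail
    band  : List E → Trail

  Infix : List E → List E → Set
  Infix q p = Σ (List E) λ xs → Σ (List E) λ ys → xs ++ (q ++ ys) ≡ p

  SubpathOf : List E → Trail → Set
  SubpathOf q (route p) = Infix q p
  SubpathOf q (band b)  = Σ ℕ λ k → Infix q (concat (replicate k b))

  module _ (ℛ : Framing) where
    open Framing ℛ

    IsIncompatibility : List E → List E → Set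
    IsIncompatibility p' q' =
      Σ E λ e₁ → Σ E λ e₂ → Σ E λ f₁ → Σ E λ f₂ → Σ (List E) λ R →
        inLt e₁ e₂ × outLt f₁ f₂ ×
        IsWalk (e₁ ∷ R ++ (f₂ ∷ [])) × IsWalk (e₂ ∷ R ++ (f₁ ∷ [])) ×
        (p' ≡ e₁ ∷ R ++ (f₂ ∷ [])) × (q' ≡ e₂ ∷ R ++ (f₁ ∷ []))

    Incompatible : Trail → Trail → Set
    Incompatible p q = Σ (List E) λ p' → Σ (List E) λ q' →
      SubpathOf p' p × SubpathOf q' q × IsIncompatibility p' q'

    Compatible : Trail → Trail → Set
    Compatible p q = ¬ Incompatible p q

    SelfCompatible : Trail → Set
    SelfCompatible p = Compatible p p

    ElementaryRoute : List E → Set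
    ElementaryRoute p = IsRoute p × SimpleRoute p × SelfCompatible (route p)

    SelfCompatibleElementaryBand : List E → Set
    SelfCompatibleElementaryBand b = IsBand b × SimpleBand b × SelfCompatible (band b)

  Vec : Set
  Vec = E → ℚ

  sumFin : ∀ {k} → (Fin k → ℚ) → ℚ
  sumFin {zero}  f = 0ℚ
  sumFin {suc k} f = f zero + sumFin (λ i → f (suc i))

  _≐_ : Vec → Vec → Set
  x ≐ y = ∀ e → x e ≡ y e

  PosMultiple : Vec → Vec → Set
  PosMultiple x y = Σ ℚ λ c → (0ℚ < c) × (∀ e → x e ≡ c * y e)

  countE : E → List E → ℕ
  countE e []       = 0
  countE e (f ∷ fs) = if does (f ≟ e) then suc (countE e fs) else countE e fs

  𝓘 : List E → Vec
  𝓘 p e = + countE e p / 1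

  inflow outflow : Vec → V → ℚ
  inflow  F v = sumFin (λ e → if does (head e ≟ v) then F e else 0ℚ)
  outflow F v = sumFin (λ e → if does (tail e ≟ v) then F e else 0ℚ)

  IsFlow : Vec → Set
  IsFlow F = ∀ v → IsInternal v → inflow F v ≡ outflow F v

  sourceOutflow : Vec → ℚ
  sourceOutflow F = sumFin (λ e → if isSourceᵇ (tail e) then F e else 0ℚ)

  -- 𝓕₁(G) (rational points)
  𝓕₁ : Vec → Set
  𝓕₁ F = (∀ e → 0ℚ ≤ F e) × IsFlow F × (sourceOutflow F ≡ 1ℚ)

  -- its recession cone {A x ≤ 0} for the defining system of 𝓕₁(G)
  RecCone𝓕₁ : Vec → Set
  RecCone𝓕₁ F = (∀ e → 0ℚ ≤ F e) × IsFlow F × (sourceOutflow F ≡ 0ℚ)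

  IsVertex : (Vec → Set) → Vec → Set
  IsVertex P x = P x × (∀ y z (λ' : ℚ) → P y → P z → 0ℚ < λ' → λ' < 1ℚ →
    x ≐ (λ e → λ' * y e + (1ℚ - λ') * z e) → y ≐ z)

  GeneratesUsing : (Vec → Set) → ∀ {k} → (Fin k → Vec) → (Fin k → Bool) → Set
  GeneratesUsing C {k} S keep = ∀ d → C d → Σ (Fin k → ℚ) λ c →
    (∀ i → 0ℚ ≤ c i) × (∀ i → keep i ≡ false → c i ≡ 0ℚ) ×
    (d ≐ (λ e → sumFin (λ i → c i * S i e)))

  MinimalGeneratingSet : (Vec → Set) → ∀ {k} → (Fin k → Vec) → Set
  MinimalGeneratingSet C {k} S = (∀ i → C (S i)) ×
    GeneratesUsing C S (λ _ → true) ×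
    (∀ keep → (Σ (Fin k) λ i → keep i ≡ false) → ¬ GeneratesUsing C S keep)

  IsExtremalRay : (Vec → Set) → Vec → Set
  IsExtremalRay C r = Σ ℕ λ k → Σ (Fin k → Vec) λ S →
    MinimalGeneratingSet C S × Σ (Fin k) λ i → PosMultiple r (S i)

record BijectionUpTo {A B : Set} (D : A → Set) (_≈A_ : A → A → Set)
                     (C : B → Set) (_≈B_ : B → B → Set) (f : A → B) : Set where
  field
    maps-to    : ∀ a → D a → C (f a)
    injective  : ∀ a a' → D a → D a' → f a ≈B f a' → a ≈A a'
    surjective : ∀ b → C b → Σ A λ a → D a × (f a ≈B b)

-- Both bijections come from following edges on which a nonnegative flow is positive.
--
-- At a vertex x of 𝓕₁ such a walk, started on an edge leaving a source, can never close
-- a cycle: x ± t·𝓘(b) would stay in 𝓕₁ for the bottleneck value t of the cycle b, making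
-- x a midpoint. So it ends at a sink along a simple route p, and the same midpoint
-- argument applied to x − 𝓘(p) gives x = 𝓘(p). Conversely a flow supported on a simple
-- route is constant along it, so 𝓘(p) is extreme. A simple walk is determined by its
-- first edge and its edge set, which gives injectivity (up to rotation for cycles).
--
-- In the recession cone, walking backwards along positive edges always closes a simple
-- cycle, and subtracting its bottleneck multiple removes an edge from the support; so the
-- simple cycle vectors generate the cone. They do so minimally: a combination equal to a
-- cycle vector only involves vectors supported inside that cycle, i.e. the vector itself.
-- Conversely, let S be a minimal generating set and s ∈ S. Every cycle vector is a
-- combination of S in which some member with positive coefficient is supported inside
-- the cycle, hence a multiple of it. Decomposing s into cycle vectors therefore either
-- meets a cycle of which s is a multiple, or expresses s through S ∖ {s}.
--
-- Self-compatibility is automatic for simple trails: an incompatibility needs two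
-- different edges of the trail entering one vertex (and two leaving another).

module Submission where

open import Defs

open import Data.Bool using (Bool; true; false; if_then_else_; not; T)
open import Data.Bool.ListAction using (any)
open import Data.Bool.Properties using (T-≡)
open import Data.Empty using (⊥; ⊥-elim)
open import Data.Fin as Fin using (Fin; zero; suc; _≟_)
import Data.Fin.Properties as Fin
open import Data.Fin.Subset as Subset using (Subset)
import Data.Fin.Subset.Properties as Subset
import Data.Integer as ℤ
import Data.Integer.Properties as ℤ
open import Data.List as List
  using (List; []; _∷_; _++_; [_]; _ʳ++_; map; concat; concatMap; replicate; length; allFin; filter; deduplicate)
import Data.List.Properties as List
open import Data.List.Membership.Propositional using (_∈_; _∉_; lose)
open import Data.List.Membership.Propositional.Properties
  using (∈-map⁺; ∈-map⁻; ∈-lookup; ∈-allFin; ∈-concatMap⁺; ∈-filter⁺)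
  using (∈-++⁺ˡ; ∈-++⁺ʳ; ∈-++⁻; ∈-∃++)
open import Data.List.Relation.Binary.Permutation.Propositional
  using (_↭_; ↭-sym; ↭-trans; ↭⇒↭ₛ; module PermutationReasoning)
open import Data.List.Relation.Binary.Permutation.Propositional.Properties
  using (∷↭∷ʳ; ∈-resp-↭; ++-comm; map⁺; ++↭ʳ++; All-resp-↭)
import Data.List.Relation.Binary.Permutation.Setoid.Properties as Permutationₛ
open import Data.List.Relation.Unary.All as All using (All; []; _∷_)
import Data.List.Relation.Unary.All.Properties as All
open import Data.List.Relation.Unary.AllPairs using (AllPairs; []; _∷_)
open import Data.List.Relation.Unary.Any as Any using (Any; here; there)
open import Data.List.Relation.Unary.Any.Properties using (any⁺; any⁻; lookup-index)
import Data.List.Relation.Unary.Any.Properties as Any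
open import Data.List.Relation.Unary.Linked using (Linked; []; [-]; _∷_; linked?)
open import Data.List.Relation.Unary.Unique.DecPropositional using (unique?)
open import Data.List.Relation.Unary.Unique.DecSetoid.Properties using (deduplicate-!)
open import Data.List.Relation.Unary.Unique.Propositional using (Unique)
import Data.List.Relation.Unary.Unique.Propositional.Properties as Unique
open import Data.Nat as ℕ using (ℕ; zero; suc)
import Data.Nat.Coprimality as Coprime
import Data.Nat.Induction as ℕ
import Data.Nat.Properties as ℕ
open import Data.Product using (Σ; ∃; _×_; _,_; proj₁; proj₂)
open import Data.Rational
  using (ℚ; mkℚ; 0ℚ; 1ℚ; ½; _+_; _*_; _-_; -_; _≤_; _<_; _/_; 1/_; NonZero; positive; nonNegative; >-nonZero)
open import Data.Rational.Properties hiding (_≟_)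
import Data.Rational.Properties as ℚ
open import Data.Rational.Solver using (module +-*-Solver)
open +-*-Solver using (solve; _:+_; _:*_; _:-_; :-_; _:=_; con)
open import Data.Sum using (_⊎_; inj₁; inj₂)
open import Data.Unit using (⊤)
import Data.Vec as Vec
import Data.Vec.Properties as Vec
open import Function using (_∘_; Equivalence)
open import Induction.WellFounded using (Acc; acc)
open import Level using (0ℓ)
open import Relation.Binary.Bundles using (DecTotalOrder; DecSetoid)
open import Relation.Binary.PropositionalEquality hiding ([_])
open import Relation.Nullary using (¬_; Dec; yes; no; does; _×-dec_)
open import Relation.Nullary.Decidable using (dec-true; dec-false; from-yes)

open import Data.List.Extrema (DecTotalOrder.totalOrder ≤-decTotalOrder)
  using (argmin; argmin-all; f[argmin]≤f[⊤]; f[argmin]≤f[xs])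

-- 𝓘 G l e is ⟦ countE G e l ⟧ by definition.
⟦_⟧ : ℕ → ℚ
⟦ n ⟧ = ℤ.+ n / 1

⟦suc⟧ : ∀ n → ⟦ suc n ⟧ ≡ 1ℚ + ⟦ n ⟧
⟦suc⟧ n = begin
  ⟦ suc n ⟧                              ≡⟨ cong (λ k → (ℤ.+ 1 ℤ.+ k) / 1) (ℤ.*-identityʳ (ℤ.+ n)) ⟨
  (ℤ.+ 1 ℤ.+ ℤ.+ n ℤ.* ℤ.+ 1) / 1        ≡⟨⟩
  mkℚ (ℤ.+ 1) 0 c₁ + mkℚ (ℤ.+ n) 0 cₙ    ≡⟨ cong₂ _+_ (normalize-coprime c₁) (normalize-coprime cₙ) ⟨
  1ℚ + ⟦ n ⟧                             ∎
  where
    open ≡-Reasoning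
    c₁ : Coprime.Coprime 1 1
    c₁ = Coprime.sym (Coprime.1-coprimeTo 1)
    cₙ : Coprime.Coprime n 1
    cₙ = Coprime.sym (Coprime.1-coprimeTo n)

0≤⟦⟧ : ∀ n → 0ℚ ≤ ⟦ n ⟧
0≤⟦⟧ n = nonNegative⁻¹ ⟦ n ⟧ {{normalize-nonNeg n 1}}

0<⟦suc⟧ : ∀ n → 0ℚ < ⟦ suc n ⟧
0<⟦suc⟧ n = positive⁻¹ ⟦ suc n ⟧ {{normalize-pos (suc n) 1}}

0<1 : 0ℚ < 1ℚ
0<1 = positive⁻¹ 1ℚ

½<1 : ½ < 1ℚ
½<1 = from-yes (½ <? 1ℚ)

+-nonNeg : ∀ {p q} → 0ℚ ≤ p → 0ℚ ≤ q → 0ℚ ≤ p + q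
+-nonNeg = +-mono-≤

*-nonNeg : ∀ {p q} → 0ℚ ≤ p → 0ℚ ≤ q → 0ℚ ≤ p * q
*-nonNeg {p} {q} 0≤p 0≤q = subst (_≤ p * q) (*-zeroʳ p) (*-monoˡ-≤-nonNeg p {{nonNegative 0≤p}} 0≤q)

*-pos : ∀ {p q} → 0ℚ < p → 0ℚ < q → 0ℚ < p * q
*-pos {p} {q} 0<p 0<q = subst (_< p * q) (*-zeroʳ p) (*-monoʳ-<-pos p {{positive 0<p}} 0<q)

pos-factorʳ : ∀ {p q} → 0ℚ ≤ p → 0ℚ < p * q → 0ℚ < q
pos-factorʳ {p} {q} 0≤p 0<pq with 0ℚ <? q
... | yes 0<q = 0<q
... | no  0≮q = ⊥-elim (<-irrefl refl (<-≤-trans 0<pq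
                  (subst (p * q ≤_) (*-zeroʳ p) (*-monoˡ-≤-nonNeg p {{nonNegative 0≤p}} (≮⇒≥ 0≮q)))))

pos-factorˡ : ∀ {p q} → 0ℚ ≤ q → 0ℚ < p * q → 0ℚ < p
pos-factorˡ {p} {q} 0≤q 0<pq = pos-factorʳ 0≤q (subst (0ℚ <_) (*-comm p q) 0<pq)

p≤p+q : ∀ {p q} → 0ℚ ≤ q → p ≤ p + q
p≤p+q {p} {q} 0≤q = subst (_≤ p + q) (+-identityʳ p) (+-monoʳ-≤ p 0≤q)

q≤p+q : ∀ {p q} → 0ℚ ≤ p → q ≤ p + q
q≤p+q {p} {q} 0≤p = subst (_≤ p + q) (+-identityˡ q) (+-monoˡ-≤ q 0≤p)

p-q≤p : ∀ {p q} → 0ℚ ≤ q → p - q ≤ p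
p-q≤p {p} {q} 0≤q = subst (p - q ≤_) (+-identityʳ p) (+-monoʳ-≤ p (neg-antimono-≤ 0≤q))

p≤q⇒0≤q-p : ∀ {p q} → p ≤ q → 0ℚ ≤ q - p
p≤q⇒0≤q-p {p} {q} p≤q = subst (_≤ q - p) (+-inverseʳ p) (+-monoˡ-≤ (- p) p≤q)

p<q⇒0<q-p : ∀ {p q} → p < q → 0ℚ < q - p
p<q⇒0<q-p {p} {q} p<q = subst (_< q - p) (+-inverseʳ p) (+-monoˡ-< (- p) p<q)

p+-q*r≡p-q*r : ∀ p q r → p + (- q) * r ≡ p - q * r
p+-q*r≡p-q*r p q r = cong (p +_) (sym (neg-distribˡ-* q r))

0≤a±t[a-b] : ∀ {a b t} → 0ℚ ≤ a → 0ℚ ≤ b → 0ℚ ≤ t → t ≤ 1ℚ → t * b ≤ a →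
  0ℚ ≤ a + t * (a + (- 1ℚ) * b) × 0ℚ ≤ a + (- t) * (a + (- 1ℚ) * b)
0≤a±t[a-b] {a} {b} {t} 0≤a 0≤b 0≤t t≤1 tb≤a =
  subst (0ℚ ≤_) (solve 3 (λ a t b → (a :- t :* b) :+ t :* a := a :+ t :* (a :+ (:- con 1ℚ) :* b)) refl a t b)
    (+-nonNeg (p≤q⇒0≤q-p tb≤a) (*-nonNeg 0≤t 0≤a)) ,
  subst (0ℚ ≤_)
    (solve 3 (λ a t b → (con 1ℚ :- t) :* a :+ t :* b := a :+ (:- t) :* (a :+ (:- con 1ℚ) :* b)) refl a t b)
    (+-nonNeg (*-nonNeg (p≤q⇒0≤q-p t≤1) 0≤a) (*-nonNeg 0≤t 0≤b))

nonNeg-+-≡0 : ∀ {p q} → 0ℚ ≤ p → 0ℚ ≤ q → p + q ≡ 0ℚ → p ≡ 0ℚ × q ≡ 0ℚ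
nonNeg-+-≡0 {p} {q} 0≤p 0≤q p+q≡0 =
  ≤-antisym (subst (p ≤_) p+q≡0 (p≤p+q 0≤q)) 0≤p , ≤-antisym (subst (q ≤_) p+q≡0 (q≤p+q 0≤p)) 0≤q

1/p*[p*q]≡q : ∀ {p} (0<p : 0ℚ < p) q → (1/ p) {{>-nonZero 0<p}} * (p * q) ≡ q
1/p*[p*q]≡q {p} 0<p q = begin
  (1/ p) * (p * q) ≡⟨ *-assoc (1/ p) p q ⟨
  ((1/ p) * p) * q ≡⟨ cong (_* q) (*-inverseˡ p) ⟩
  1ℚ * q           ≡⟨ *-identityˡ q ⟩
  q                ∎
  where
    open ≡-Reasoning
    instance
      p≢0 : NonZero p
      p≢0 = >-nonZero 0<p

0<1/p : ∀ {p} (0<p : 0ℚ < p) → 0ℚ < (1/ p) {{>-nonZero 0<p}}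
0<1/p {p} 0<p = positive⁻¹ _ {{1/pos⇒pos p {{positive 0<p}}}}

pos*q≡0⇒q≡0 : ∀ {p q} → 0ℚ < p → p * q ≡ 0ℚ → q ≡ 0ℚ
pos*q≡0⇒q≡0 {p} {q} 0<p pq≡0 = begin
  q                ≡⟨ 1/p*[p*q]≡q 0<p q ⟨
  (1/ p) * (p * q) ≡⟨ cong ((1/ p) *_) pq≡0 ⟩
  (1/ p) * 0ℚ      ≡⟨ *-zeroʳ (1/ p) ⟩
  0ℚ               ∎
  where
    open ≡-Reasoning
    instance
      p≢0 : NonZero p
      p≢0 = >-nonZero 0<p

convexCombination-≡0 : ∀ {λ' p q} → 0ℚ < λ' → λ' < 1ℚ → 0ℚ ≤ p → 0ℚ ≤ q →
  λ' * p + (1ℚ - λ') * q ≡ 0ℚ → p ≡ 0ℚ × q ≡ 0ℚ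
convexCombination-≡0 {λ'} {p} {q} 0<λ λ<1 0≤p 0≤q sum≡0 =
  pos*q≡0⇒q≡0 0<λ (proj₁ summands≡0) , pos*q≡0⇒q≡0 0<μ (proj₂ summands≡0)
  where
    0<μ : 0ℚ < 1ℚ - λ'
    0<μ = p<q⇒0<q-p λ<1
    summands≡0 : λ' * p ≡ 0ℚ × (1ℚ - λ') * q ≡ 0ℚ
    summands≡0 = nonNeg-+-≡0 (*-nonNeg (<⇒≤ 0<λ) 0≤p) (*-nonNeg (<⇒≤ 0<μ) 0≤q) sum≡0

module _ {A : Set} where

  unique-++⁻ˡ : ∀ xs {ys : List A} → Unique (xs ++ ys) → Unique xs
  unique-++⁻ˡ []       _         = []
  unique-++⁻ˡ (x ∷ xs) (x∉ ∷ u) = All.++⁻ˡ xs x∉ ∷ unique-++⁻ˡ xs u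

  unique-resp-↭ : ∀ {xs ys : List A} → xs ↭ ys → Unique xs → Unique ys
  unique-resp-↭ xs↭ys = Permutationₛ.Unique-resp-↭ (setoid A) (↭⇒↭ₛ xs↭ys)

  linked-++⁻ˡ : ∀ {R : A → A → Set} xs {ys} → Linked R (xs ++ ys) → Linked R xs
  linked-++⁻ˡ []           _         = []
  linked-++⁻ˡ (x ∷ [])     _         = [-]
  linked-++⁻ˡ (x ∷ y ∷ xs) (r ∷ rs) = r ∷ linked-++⁻ˡ (y ∷ xs) rs

  unique-middle : ∀ xs {y} {ys : List A} → Unique (xs ++ y ∷ ys) → y ∉ xs
  unique-middle (x ∷ xs) (x∉ ∷ _) (here refl) = All.lookup x∉ (∈-++⁺ʳ xs (here refl)) refl
  unique-middle (x ∷ xs) (_ ∷ u)  (there y∈)  = unique-middle xs u y∈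

module _ {A B : Set} (f : A → B) where

  unique-map-injective : ∀ {l x y} → Unique (map f l) → x ∈ l → y ∈ l → f x ≡ f y → x ≡ y
  unique-map-injective (_   ∷ _) (here refl) (here refl) _     = refl
  unique-map-injective (fx∉ ∷ _) (here refl) (there y∈)  fx≡fy = ⊥-elim (All.lookup fx∉ (∈-map⁺ f y∈) fx≡fy)
  unique-map-injective (fy∉ ∷ _) (there x∈)  (here refl) fx≡fy = ⊥-elim (All.lookup fy∉ (∈-map⁺ f x∈) (sym fx≡fy))
  unique-map-injective (_   ∷ u) (there x∈)  (there y∈)  fx≡fy = unique-map-injective u x∈ y∈ fx≡fy

does-true⇒ : ∀ {A : Set} (a? : Dec A) → does a? ≡ true → A
does-true⇒ (yes a) _ = a

module _ {A : Set} (P : A → Bool) where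

  countᵇ : List A → ℕ
  countᵇ []       = 0
  countᵇ (x ∷ xs) = if P x then suc (countᵇ xs) else countᵇ xs

  countᵇ-∷-false : ∀ x xs → P x ≡ false → countᵇ (x ∷ xs) ≡ countᵇ xs
  countᵇ-∷-false x xs Px≡false rewrite Px≡false = refl

  countᵇ-∷-cancel : ∀ x xs ys → countᵇ (x ∷ xs) ≡ countᵇ (x ∷ ys) → countᵇ xs ≡ countᵇ ys
  countᵇ-∷-cancel x xs ys eq with P x
  ... | true  = ℕ.suc-injective eq
  ... | false = eq

  countᵇ-∷ʳ : ∀ xs x → countᵇ (xs ++ [ x ]) ≡ countᵇ (x ∷ xs)
  countᵇ-∷ʳ []       x = refl
  countᵇ-∷ʳ (y ∷ xs) x with P x | P y | countᵇ-∷ʳ xs x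
  ... | true  | true  | eq = cong suc eq
  ... | true  | false | eq = eq
  ... | false | true  | eq = cong suc eq
  ... | false | false | eq = eq

  countᵇ-none : ∀ xs → (∀ {x} → x ∈ xs → P x ≡ false) → countᵇ xs ≡ 0
  countᵇ-none []       _     = refl
  countᵇ-none (x ∷ xs) none rewrite none (here refl) = countᵇ-none xs (none ∘ there)

countᵇ-map : ∀ {A B : Set} (P : B → Bool) (f : A → B) xs → countᵇ (P ∘ f) xs ≡ countᵇ P (map f xs)
countᵇ-map P f []       = refl
countᵇ-map P f (x ∷ xs) with P (f x)
... | true  = cong suc (countᵇ-map P f xs)
... | false = countᵇ-map P f xs

allPairs-lookup-injective : ∀ {A : Set} {R : A → A → Set} → (∀ {x y} → R x y → R y x) →
  ∀ {xs} → AllPairs (λ x y → ¬ R x y) xs → ∀ i j → R (List.lookup xs i) (List.lookup xs j) → i ≡ j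
allPairs-lookup-injective R-sym (_  ∷ _)  zero    zero    _ = refl
allPairs-lookup-injective R-sym (x≉ ∷ _)  zero    (suc j) R = ⊥-elim (All.lookup x≉ (∈-lookup j) R)
allPairs-lookup-injective R-sym (x≉ ∷ _)  (suc i) zero    R = ⊥-elim (All.lookup x≉ (∈-lookup i) (R-sym R))
allPairs-lookup-injective R-sym (_  ∷ xs≉) (suc i) (suc j) R = cong suc (allPairs-lookup-injective R-sym xs≉ i j R)

unique-length≤ : ∀ {n} (xs : List (Fin n)) → Unique xs → length xs ℕ.≤ n
unique-length≤ {n} xs xs! with length xs ℕ.≤? n
... | yes ≤n = ≤n
... | no  ≰n with i , j , i<j , xsᵢ≡xsⱼ ← Fin.pigeonhole (ℕ.≰⇒> ≰n) (List.lookup xs) =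
  ⊥-elim (Fin.<-irrefl (allPairs-lookup-injective sym xs! i j xsᵢ≡xsⱼ) i<j)

listsUpTo : ∀ {m} → ℕ → List (List (Fin m))
listsUpTo zero    = [ [] ]
listsUpTo (suc n) = [] ∷ concatMap (λ x → map (x ∷_) (listsUpTo n)) (allFin _)

∈-listsUpTo : ∀ {m} n (xs : List (Fin m)) → length xs ℕ.≤ n → xs ∈ listsUpTo n
∈-listsUpTo zero    []       _           = here refl
∈-listsUpTo (suc n) []       _           = here refl
∈-listsUpTo (suc n) (x ∷ xs) (ℕ.s≤s ≤n) =
  there (∈-concatMap⁺ (λ y → map (y ∷_) (listsUpTo n)) (lose (∈-allFin x) (∈-map⁺ (x ∷_) (∈-listsUpTo n xs ≤n))))

module WalksAndFlows (G : Graph) where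
  open Graph G
  open import Data.List.Membership.DecPropositional (_≟_ {nE}) using (_∈?_)
  open import Data.List.Membership.DecPropositional (_≟_ {nV}) using () renaming (_∈?_ to _∈ᵥ?_)

  sum-cong : ∀ {k} {f g : Fin k → ℚ} → (∀ i → f i ≡ g i) → sumFin G f ≡ sumFin G g
  sum-cong {zero}  f≗g = refl
  sum-cong {suc k} f≗g = cong₂ _+_ (f≗g zero) (sum-cong (f≗g ∘ suc))

  sum-zero : ∀ {k} {f : Fin k → ℚ} → (∀ i → f i ≡ 0ℚ) → sumFin G f ≡ 0ℚ
  sum-zero {k} f≗0 = trans (sum-cong f≗0) (sum-const0 k)
    where
      sum-const0 : ∀ k → sumFin G {k} (λ _ → 0ℚ) ≡ 0ℚ
      sum-const0 zero    = refl
      sum-const0 (suc k) = trans (+-identityˡ _) (sum-const0 k)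

  sum-+ : ∀ {k} (f g : Fin k → ℚ) → sumFin G (λ i → f i + g i) ≡ sumFin G f + sumFin G g
  sum-+ {zero}  f g = sym (+-identityˡ 0ℚ)
  sum-+ {suc k} f g = trans (cong ((f zero + g zero) +_) (sum-+ (f ∘ suc) (g ∘ suc)))
    (solve 4 (λ a b c d → (a :+ b) :+ (c :+ d) := (a :+ c) :+ (b :+ d)) refl (f zero) (g zero) _ _)

  sum-* : ∀ {k} c (f : Fin k → ℚ) → sumFin G (λ i → c * f i) ≡ c * sumFin G f
  sum-* {zero}  c f = sym (*-zeroʳ c)
  sum-* {suc k} c f = trans (cong (c * f zero +_) (sum-* c (f ∘ suc))) (sym (*-distribˡ-+ c (f zero) _))

  sum-nonNeg : ∀ {k} {f : Fin k → ℚ} → (∀ i → 0ℚ ≤ f i) → 0ℚ ≤ sumFin G f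
  sum-nonNeg {zero}  0≤f = ≤-refl
  sum-nonNeg {suc k} 0≤f = +-nonNeg (0≤f zero) (sum-nonNeg (0≤f ∘ suc))

  term≤sum : ∀ {k} {f : Fin k → ℚ} → (∀ i → 0ℚ ≤ f i) → ∀ j → f j ≤ sumFin G f
  term≤sum {suc k} {f} 0≤f zero    = p≤p+q (sum-nonNeg (0≤f ∘ suc))
  term≤sum {suc k} {f} 0≤f (suc j) = ≤-trans (term≤sum (0≤f ∘ suc) j) (q≤p+q (0≤f zero))

  sum-single : ∀ {k} {f : Fin k → ℚ} j → (∀ i → i ≢ j → f i ≡ 0ℚ) → sumFin G f ≡ f j
  sum-single {suc k} {f} zero    f≗0 = trans (cong (f zero +_) (sum-zero (λ i → f≗0 (suc i) λ ()))) (+-identityʳ _)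
  sum-single {suc k} {f} (suc j) f≗0 =
    trans (cong₂ _+_ (f≗0 zero λ ()) (sum-single j (λ i i≢j → f≗0 (suc i) (i≢j ∘ Fin.suc-injective))))
          (+-identityˡ _)

  sum-pos⇒term-pos : ∀ {k} {f : Fin k → ℚ} → 0ℚ < sumFin G f → ∃ λ i → 0ℚ < f i
  sum-pos⇒term-pos {zero}      0<0 = ⊥-elim (<-irrefl refl 0<0)
  sum-pos⇒term-pos {suc k} {f} 0<Σ with 0ℚ <? f zero
  ... | yes 0<f₀ = zero , 0<f₀
  ... | no  0≮f₀ with 0ℚ <? sumFin G (f ∘ suc)
  ...   | yes 0<rest = let i , 0<fᵢ = sum-pos⇒term-pos 0<rest in suc i , 0<fᵢ
  ...   | no  0≮rest = ⊥-elim (<-irrefl refl (<-≤-trans 0<Σ (+-mono-≤ (≮⇒≥ 0≮f₀) (≮⇒≥ 0≮rest))))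

  IsClosed : List (E G) → Set
  IsClosed []       = ⊤
  IsClosed (e ∷ es) = head (lastOf G e es) ≡ tail e

  IsSimpleCycle : List (E G) → Set
  IsSimpleCycle []       = ⊥
  IsSimpleCycle (e ∷ es) = IsWalk G (e ∷ es) × IsClosed (e ∷ es) × Unique (map tail (e ∷ es))

  lastOf-++ : ∀ e es f fs → lastOf G e (es ++ f ∷ fs) ≡ lastOf G f fs
  lastOf-++ e []       f fs = refl
  lastOf-++ e (x ∷ es) f fs = lastOf-++ x es f fs

  walk-vertices : ∀ e es → IsWalk G (e ∷ es) →
    map tail (e ∷ es) ++ [ head (lastOf G e es) ] ≡ tail e ∷ map head (e ∷ es)
  walk-vertices e []       [-]       = refl
  walk-vertices e (f ∷ fs) (e→f ∷ w) =
    cong (tail e ∷_) (trans (walk-vertices f fs w) (cong (_∷ map head (f ∷ fs)) (sym e→f)))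

  closedWalk-heads↭tails : ∀ e es → IsWalk G (e ∷ es) → IsClosed (e ∷ es) →
    map head (e ∷ es) ↭ map tail (e ∷ es)
  closedWalk-heads↭tails e es w closed = begin
    map head (e ∷ es)                       ≡⟨ List.∷-injectiveʳ (walk-vertices e es w) ⟨
    map tail es ++ [ head (lastOf G e es) ] ≡⟨ cong (λ v → map tail es ++ [ v ]) closed ⟩
    map tail es ++ [ tail e ]               ↭⟨ ↭-sym (∷↭∷ʳ (tail e) (map tail es)) ⟩
    map tail (e ∷ es)                       ∎
    where open PermutationReasoning

  walk-source-first : ∀ e es {x} → IsWalk G (e ∷ es) → x ∈ e ∷ es → IsSource G (tail x) → x ≡ e
  walk-source-first e es       _         (here refl) _      = refl
  walk-source-first e (f ∷ fs) (e→f ∷ w) (there x∈)  source with walk-source-first f fs w x∈ source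
  ... | refl = ⊥-elim (source e e→f)

  walk-snoc : ∀ e es x → IsWalk G (e ∷ es) → head (lastOf G e es) ≡ tail x → IsWalk G (e ∷ es ++ [ x ])
  walk-snoc e []       x [-]        last→x = last→x ∷ [-]
  walk-snoc e (f ∷ fs) x (e→f ∷ w) last→x = e→f ∷ walk-snoc f fs x w last→x

  walk-split : ∀ e pre g post → IsWalk G (e ∷ pre ++ g ∷ post) → head (lastOf G e pre) ≡ tail g
  walk-split e []        g post (e→g ∷ _) = e→g
  walk-split e (x ∷ pre) g post (_ ∷ w)   = walk-split x pre g post w

  closedWalk-rotate₁ : ∀ x xs → IsWalk G (x ∷ xs) → IsClosed (x ∷ xs) →
    IsWalk G (xs ++ [ x ]) × IsClosed (xs ++ [ x ])
  closedWalk-rotate₁ x []       w         closed = w , closed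
  closedWalk-rotate₁ x (y ∷ ys) (x→y ∷ w) closed =
    walk-snoc y ys x w closed , trans (cong head (lastOf-++ y ys x [])) x→y

  closedWalk-rotate : ∀ xs e ys → IsWalk G (xs ++ e ∷ ys) → IsClosed (xs ++ e ∷ ys) →
    IsWalk G (e ∷ ys ++ xs) × IsClosed (e ∷ ys ++ xs)
  closedWalk-rotate []       e ys w closed rewrite List.++-identityʳ ys = w , closed
  closedWalk-rotate (x ∷ xs) e ys w closed
    with w′ , closed′ ← closedWalk-rotate₁ x (xs ++ e ∷ ys) w closed
    rewrite List.++-assoc xs (e ∷ ys) [ x ]
    with w″ , closed″ ← closedWalk-rotate xs e (ys ++ [ x ]) w′ closed′
    rewrite List.++-assoc ys [ x ] xs = w″ , closed″

  simpleWalks-≡ : ∀ e p p' → IsWalk G (e ∷ p) → IsWalk G (e ∷ p') →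
    Unique (map tail (e ∷ p)) → Unique (map tail (e ∷ p')) →
    (∀ {x} → x ∈ e ∷ p → x ∈ e ∷ p') → (∀ {x} → x ∈ e ∷ p' → x ∈ e ∷ p) → p ≡ p'
  simpleWalks-≡ e [] [] _ _ _ _ _ _ = refl
  simpleWalks-≡ e [] (f' ∷ _) _ _ _ (e∉ ∷ _) _ ⊇ with ⊇ (there (here refl))
  ... | here refl = ⊥-elim (All.lookup e∉ (here refl) refl)
  simpleWalks-≡ e (f ∷ _) [] _ _ (e∉ ∷ _) _ ⊆ _ with ⊆ (there (here refl))
  ... | here refl = ⊥-elim (All.lookup e∉ (here refl) refl)
  simpleWalks-≡ e (f ∷ q) (f' ∷ q') (e→f ∷ w) (e→f' ∷ w') (e∉ ∷ u) (e∉' ∷ u') ⊆ ⊇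
    with ⊆ (there (here refl))
  ... | here refl = ⊥-elim (All.lookup e∉ (here refl) refl)
  ... | there f∈p' with unique-map-injective tail u' f∈p' (here refl) (trans (sym e→f) e→f')
  ...   | refl = cong (f ∷_) (simpleWalks-≡ f q q' w w' u u' (drop-e (All.All¬⇒¬Any e∉) ⊆)
                                                           (drop-e (All.All¬⇒¬Any e∉') ⊇))
    where
      drop-e : ∀ {l l'} → tail e ∉ map tail l → (∀ {x} → x ∈ e ∷ l → x ∈ e ∷ l') →
        ∀ {x} → x ∈ l → x ∈ l'
      drop-e e∉l ⊆′ x∈ with ⊆′ (there x∈)
      ... | here refl = ⊥-elim (e∉l (∈-map⁺ tail x∈))
      ... | there x∈' = x∈'

  countE-∉ : ∀ {e} l → e ∉ l → countE G e l ≡ 0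
  countE-∉ {e} []      _   = refl
  countE-∉ {e} (f ∷ l) e∉ with f ≟ e
  ... | yes refl = ⊥-elim (e∉ (here refl))
  ... | no  _    = countE-∉ l (e∉ ∘ there)

  countE-unique-∈ : ∀ {e} l → Unique l → e ∈ l → countE G e l ≡ 1
  countE-unique-∈ {e} (f ∷ l) (f∉ ∷ u) e∈ with f ≟ e | e∈
  ... | yes refl | _          = cong suc (countE-∉ l (All.All¬⇒¬Any f∉))
  ... | no  f≢e  | here refl  = ⊥-elim (f≢e refl)
  ... | no  _    | there e∈l = countE-unique-∈ l u e∈l

  countE-∈ : ∀ {e} l → e ∈ l → ∃ λ n → countE G e l ≡ suc n
  countE-∈ {e} (f ∷ l) e∈ with f ≟ e | e∈
  ... | yes _    | _          = countE G e l , refl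
  ... | no  f≢e  | here refl  = ⊥-elim (f≢e refl)
  ... | no  _    | there e∈l = countE-∈ l e∈l

  𝓘-∉ : ∀ {e l} → e ∉ l → 𝓘 G l e ≡ 0ℚ
  𝓘-∉ {l = l} e∉l = cong ⟦_⟧ (countE-∉ l e∉l)

  𝓘-unique-∈ : ∀ {e l} → Unique l → e ∈ l → 𝓘 G l e ≡ 1ℚ
  𝓘-unique-∈ {l = l} u e∈l = cong ⟦_⟧ (countE-unique-∈ l u e∈l)

  0≤𝓘 : ∀ l e → 0ℚ ≤ 𝓘 G l e
  0≤𝓘 l e = 0≤⟦⟧ (countE G e l)

  ∈⇒0<𝓘 : ∀ {e l} → e ∈ l → 0ℚ < 𝓘 G l e
  ∈⇒0<𝓘 {l = l} e∈l with n , eq ← countE-∈ l e∈l = subst (0ℚ <_) (sym (cong ⟦_⟧ eq)) (0<⟦suc⟧ n)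

  0<𝓘⇒∈ : ∀ {e} l → 0ℚ < 𝓘 G l e → e ∈ l
  0<𝓘⇒∈ {e} l 0<𝓘 with e ∈? l
  ... | yes e∈l = e∈l
  ... | no  e∉l = ⊥-elim (<-irrefl (sym (𝓘-∉ e∉l)) 0<𝓘)

  mask : (E G → Bool) → Vec G → Vec G
  mask q x e = if q e then x e else 0ℚ

  maskedSum : (E G → Bool) → Vec G → ℚ
  maskedSum q x = sumFin G (mask q x)

  mask-nonNeg : ∀ q {x} → (∀ e → 0ℚ ≤ x e) → ∀ e → 0ℚ ≤ mask q x e
  mask-nonNeg q 0≤x e with q e
  ... | true  = 0≤x e
  ... | false = ≤-refl

  mask-true : ∀ q x {f} → q f ≡ true → mask q x f ≡ x f
  mask-true q x qf rewrite qf = refl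

  maskedSum-+ : ∀ q x y → maskedSum q (λ e → x e + y e) ≡ maskedSum q x + maskedSum q y
  maskedSum-+ q x y = trans (sum-cong split) (sum-+ (mask q x) (mask q y))
    where
      split : ∀ e → mask q (λ e → x e + y e) e ≡ mask q x e + mask q y e
      split e with q e
      ... | true  = refl
      ... | false = sym (+-identityˡ 0ℚ)

  maskedSum-* : ∀ q s x → maskedSum q (λ e → s * x e) ≡ s * maskedSum q x
  maskedSum-* q s x = trans (sum-cong split) (sum-* s (mask q x))
    where
      split : ∀ e → mask q (λ e → s * x e) e ≡ s * mask q x e
      split e with q e
      ... | true  = refl
      ... | false = sym (*-zeroʳ s)

  maskedSum-linear : ∀ q x y s → maskedSum q (λ e → x e + s * y e) ≡ maskedSum q x + s * maskedSum q y
  maskedSum-linear q x y s =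
    trans (maskedSum-+ q x (λ e → s * y e)) (cong (maskedSum q x +_) (maskedSum-* q s y))

  maskedSum-single : ∀ q x f → q f ≡ true → (∀ e → e ≢ f → q e ≡ true → x e ≡ 0ℚ) →
    maskedSum q x ≡ x f
  maskedSum-single q x f qf only-f = trans (sum-single f others) (mask-true q x qf)
    where
      others : ∀ e → e ≢ f → mask q x e ≡ 0ℚ
      others e e≢f with q e in qe
      ... | true  = only-f e e≢f qe
      ... | false = refl

  term≤maskedSum : ∀ q x f → q f ≡ true → (∀ e → 0ℚ ≤ x e) → x f ≤ maskedSum q x
  term≤maskedSum q x f qf 0≤x = subst (_≤ maskedSum q x) (mask-true q x qf) (term≤sum (mask-nonNeg q 0≤x) f)

  maskedSum-pos : ∀ q x → 0ℚ < maskedSum q x → ∃ λ f → q f ≡ true × 0ℚ < x f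
  maskedSum-pos q x 0<Σ with f , 0<xf ← sum-pos⇒term-pos 0<Σ with q f in qf
  ... | true  = f , qf , 0<xf
  ... | false = ⊥-elim (<-irrefl refl 0<xf)

  unit : E G → Vec G
  unit f e = if does (f ≟ e) then 1ℚ else 0ℚ

  𝓘-∷ : ∀ f l e → 𝓘 G (f ∷ l) e ≡ unit f e + 𝓘 G l e
  𝓘-∷ f l e with f ≟ e
  ... | yes _ = ⟦suc⟧ (countE G e l)
  ... | no  _ = sym (+-identityˡ _)

  maskedSum-unit : ∀ q f → maskedSum q (unit f) ≡ (if q f then 1ℚ else 0ℚ)
  maskedSum-unit q f with q f in qf
  ... | true  = trans (maskedSum-single q (unit f) f qf (λ e e≢f _ → unit-≢ e≢f)) unit-≡
    where
      unit-≢ : ∀ {e} → e ≢ f → unit f e ≡ 0ℚ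
      unit-≢ {e} e≢f with f ≟ e
      ... | yes f≡e = ⊥-elim (e≢f (sym f≡e))
      ... | no  _   = refl
      unit-≡ : unit f f ≡ 1ℚ
      unit-≡ with f ≟ f
      ... | yes _   = refl
      ... | no  f≢f = ⊥-elim (f≢f refl)
  ... | false = sum-zero masked-unit-zero
    where
      masked-unit-zero : ∀ e → mask q (unit f) e ≡ 0ℚ
      masked-unit-zero e with f ≟ e | q e in qe
      ... | yes refl | true with () ← trans (sym qe) qf
      ... | yes _    | false = refl
      ... | no  _    | true  = refl
      ... | no  _    | false = refl

  maskedSum-𝓘 : ∀ q l → maskedSum q (𝓘 G l) ≡ ⟦ countᵇ q l ⟧
  maskedSum-𝓘 q []      = sum-zero (λ e → if-same (q e))
    where
      if-same : ∀ b → (if b then 0ℚ else 0ℚ) ≡ 0ℚ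
      if-same true  = refl
      if-same false = refl
  maskedSum-𝓘 q (f ∷ l) = begin
    maskedSum q (𝓘 G (f ∷ l))                   ≡⟨ sum-cong (λ e → cong (mask-at e) (𝓘-∷ f l e)) ⟩
    maskedSum q (λ e → unit f e + 𝓘 G l e)      ≡⟨ maskedSum-+ q (unit f) (𝓘 G l) ⟩
    maskedSum q (unit f) + maskedSum q (𝓘 G l)  ≡⟨ cong₂ _+_ (maskedSum-unit q f) (maskedSum-𝓘 q l) ⟩
    (if q f then 1ℚ else 0ℚ) + ⟦ countᵇ q l ⟧   ≡⟨ count-step (q f) ⟩
    ⟦ countᵇ q (f ∷ l) ⟧                        ∎
    where
      open ≡-Reasoning
      mask-at : E G → ℚ → ℚ
      mask-at e z = if q e then z else 0ℚ
      count-step : ∀ b → (if b then 1ℚ else 0ℚ) + ⟦ countᵇ q l ⟧ ≡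
                         ⟦ (if b then suc (countᵇ q l) else countᵇ q l) ⟧
      count-step true  = sym (⟦suc⟧ (countᵇ q l))
      count-step false = +-identityˡ ⟦ countᵇ q l ⟧

  isSourceᵇ-head : ∀ f → isSourceᵇ G (head f) ≡ false
  isSourceᵇ-head f = cong not (Equivalence.to T-≡ (any⁺ _ (lose (∈-allFin f) f-hits)))
    where
      f-hits : T (does (head f ≟ head f))
      f-hits = Equivalence.from T-≡ (dec-true (head f ≟ head f) refl)

  isSourceᵇ-complete : ∀ {v} → IsSource G v → isSourceᵇ G v ≡ true
  isSourceᵇ-complete {v} source with any (λ e → does (head e ≟ v)) (allFin nE) in hit
  ... | false = refl
  ... | true with e , hit-e ← Any.satisfied (any⁻ _ (allFin nE) (Equivalence.from T-≡ hit)) with head e ≟ v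
  ...   | yes he≡v = ⊥-elim (source e he≡v)

  isSourceᵇ-sound : ∀ {v} → isSourceᵇ G v ≡ true → IsSource G v
  isSourceᵇ-sound isSrc e refl with () ← trans (sym isSrc) (isSourceᵇ-head e)

  inflow-𝓘 : ∀ l v → inflow G (𝓘 G l) v ≡ ⟦ countᵇ (λ u → does (u ≟ v)) (map head l) ⟧
  inflow-𝓘 l v = trans (maskedSum-𝓘 _ l) (cong ⟦_⟧ (countᵇ-map _ head l))

  outflow-𝓘 : ∀ l v → outflow G (𝓘 G l) v ≡ ⟦ countᵇ (λ u → does (u ≟ v)) (map tail l) ⟧
  outflow-𝓘 l v = trans (maskedSum-𝓘 _ l) (cong ⟦_⟧ (countᵇ-map _ tail l))

  sourceOutflow-𝓘 : ∀ l → sourceOutflow G (𝓘 G l) ≡ ⟦ countᵇ (isSourceᵇ G) (map tail l) ⟧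
  sourceOutflow-𝓘 l = trans (maskedSum-𝓘 _ l) (cong ⟦_⟧ (countᵇ-map _ tail l))

  walk-count : ∀ (P : V G → Bool) e es → IsWalk G (e ∷ es) →
    countᵇ P (tail e ∷ map head (e ∷ es)) ≡ countᵇ P (head (lastOf G e es) ∷ map tail (e ∷ es))
  walk-count P e es w = trans (cong (countᵇ P) (sym (walk-vertices e es w))) (countᵇ-∷ʳ P (map tail (e ∷ es)) _)

  heads-not-sources : ∀ l → countᵇ (isSourceᵇ G) (map head l) ≡ 0
  heads-not-sources l = countᵇ-none _ (map head l) λ h∈ → let f , _ , h≡ = ∈-map⁻ head h∈ in
    subst (λ v → isSourceᵇ G v ≡ false) (sym h≡) (isSourceᵇ-head f)

  route-𝓕₁ : ∀ p → IsRoute G p → 𝓕₁ G (𝓘 G p)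
  route-𝓕₁ p (e , es , refl , w , source , sink) = 0≤𝓘 p , conservation , unit-outflow
    where
      last : V G
      last = head (lastOf G e es)

      conservation : IsFlow G (𝓘 G p)
      conservation v (¬source , ¬sink) = begin
        inflow G (𝓘 G p) v                    ≡⟨ inflow-𝓘 p v ⟩
        ⟦ countᵇ at-v (map head p) ⟧          ≡⟨ cong ⟦_⟧ (countᵇ-∷-false at-v (tail e) (map head p) tail-e≢v) ⟨
        ⟦ countᵇ at-v (tail e ∷ map head p) ⟧ ≡⟨ cong ⟦_⟧ (walk-count at-v e es w) ⟩
        ⟦ countᵇ at-v (last ∷ map tail p) ⟧   ≡⟨ cong ⟦_⟧ (countᵇ-∷-false at-v last (map tail p) last≢v) ⟩
        ⟦ countᵇ at-v (map tail p) ⟧          ≡⟨ outflow-𝓘 p v ⟨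
        outflow G (𝓘 G p) v                   ∎
        where
          open ≡-Reasoning
          at-v : V G → Bool
          at-v u = does (u ≟ v)
          tail-e≢v : at-v (tail e) ≡ false
          tail-e≢v = dec-false (tail e ≟ v) λ tail-e≡v → ¬source (subst (IsSource G) tail-e≡v source)
          last≢v : at-v last ≡ false
          last≢v = dec-false (last ≟ v) λ last≡v → ¬sink (subst (IsSink G) last≡v sink)

      unit-outflow : sourceOutflow G (𝓘 G p) ≡ 1ℚ
      unit-outflow = begin
        sourceOutflow G (𝓘 G p)              ≡⟨ sourceOutflow-𝓘 p ⟩
        ⟦ countᵇ src (map tail p) ⟧          ≡⟨ cong ⟦_⟧ (countᵇ-∷-false src last (map tail p) (isSourceᵇ-head _)) ⟨
        ⟦ countᵇ src (last ∷ map tail p) ⟧   ≡⟨ cong ⟦_⟧ (walk-count src e es w) ⟨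
        ⟦ countᵇ src (tail e ∷ map head p) ⟧ ≡⟨ cong (λ b → ⟦ (if b then suc n else n) ⟧) (isSourceᵇ-complete source) ⟩
        ⟦ suc n ⟧                            ≡⟨ cong (⟦_⟧ ∘ suc) (heads-not-sources p) ⟩
        1ℚ                                   ∎
        where
          open ≡-Reasoning
          src : V G → Bool
          src = isSourceᵇ G
          n : ℕ
          n = countᵇ src (map head p)

  closedWalk-count : ∀ (P : V G → Bool) e es → IsWalk G (e ∷ es) → IsClosed (e ∷ es) →
    countᵇ P (map head (e ∷ es)) ≡ countᵇ P (map tail (e ∷ es))
  closedWalk-count P e es w closed = countᵇ-∷-cancel P (tail e) (map head (e ∷ es)) (map tail (e ∷ es))
    (subst (λ u → countᵇ P (tail e ∷ map head (e ∷ es)) ≡ countᵇ P (u ∷ map tail (e ∷ es))) closed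
           (walk-count P e es w))

  closedWalk-recCone : ∀ e es → IsWalk G (e ∷ es) → IsClosed (e ∷ es) → RecCone𝓕₁ G (𝓘 G (e ∷ es))
  closedWalk-recCone e es w closed = 0≤𝓘 (e ∷ es) , conservation , zero-outflow
    where
      conservation : IsFlow G (𝓘 G (e ∷ es))
      conservation v _ = trans (inflow-𝓘 (e ∷ es) v)
        (trans (cong ⟦_⟧ (closedWalk-count (λ u → does (u ≟ v)) e es w closed)) (sym (outflow-𝓘 (e ∷ es) v)))

      zero-outflow : sourceOutflow G (𝓘 G (e ∷ es)) ≡ 0ℚ
      zero-outflow = trans (sourceOutflow-𝓘 (e ∷ es))
        (cong ⟦_⟧ (trans (sym (closedWalk-count (isSourceᵇ G) e es w closed)) (heads-not-sources (e ∷ es))))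

  supportedFlow-constant : ∀ e es → IsWalk G (e ∷ es) →
    Unique (map head (e ∷ es)) → Unique (map tail (e ∷ es)) →
    ∀ y → IsFlow G y → (∀ f → f ∉ e ∷ es → y f ≡ 0ℚ) → ∀ {x} → x ∈ e ∷ es → y x ≡ y e
  supportedFlow-constant e es w heads! tails! y y-flow y-supp = along e es w (λ x∈ → x∈)
    where
      l : List (E G)
      l = e ∷ es

      only-in-support : ∀ (end : E G → V G) → Unique (map end l) → ∀ {a} → a ∈ l →
        ∀ f → f ≢ a → does (end f ≟ end a) ≡ true → y f ≡ 0ℚ
      only-in-support end end! {a} a∈ f f≢a same-end with f ∈? l
      ... | yes f∈ = ⊥-elim (f≢a (unique-map-injective end end! f∈ a∈ (does-true⇒ (end f ≟ end a) same-end)))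
      ... | no  f∉ = y-supp f f∉

      through : ∀ {a a'} → a ∈ l → a' ∈ l → head a ≡ tail a' → y a ≡ y a'
      through {a} {a'} a∈ a'∈ a→a' = begin
        y a                   ≡⟨ maskedSum-single _ y a (hits head a) (only-in-support head heads! a∈) ⟨
        inflow G y (head a)   ≡⟨ y-flow (head a) ((λ source → source a refl) , (λ sink → sink a' (sym a→a'))) ⟩
        outflow G y (head a)  ≡⟨ cong (outflow G y) a→a' ⟩
        outflow G y (tail a') ≡⟨ maskedSum-single _ y a' (hits tail a') (only-in-support tail tails! a'∈) ⟩
        y a'                  ∎
        where
          open ≡-Reasoning
          hits : ∀ (end : E G → V G) f → does (end f ≟ end f) ≡ true
          hits end f = dec-true (end f ≟ end f) refl

      along : ∀ f fs → IsWalk G (f ∷ fs) → (∀ {x} → x ∈ f ∷ fs → x ∈ l) →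
        ∀ {x} → x ∈ f ∷ fs → y x ≡ y f
      along f fs       _         _ (here refl) = refl
      along f (g ∷ gs) (f→g ∷ w) ⊆ (there x∈) =
        trans (along g gs w (⊆ ∘ there) x∈) (sym (through (⊆ (here refl)) (⊆ (there (here refl))) f→g))

  simpleRoute-tails! : ∀ e es → IsWalk G (e ∷ es) → SimpleRoute G (e ∷ es) → Unique (map tail (e ∷ es))
  simpleRoute-tails! e es w vertices! =
    unique-++⁻ˡ (map tail (e ∷ es)) (subst Unique (sym (walk-vertices e es w)) vertices!)

  supportedFlow-route : ∀ p → IsRoute G p → SimpleRoute G p →
    ∀ y → 𝓕₁ G y → (∀ f → f ∉ p → y f ≡ 0ℚ) → y ≗ 𝓘 G p
  supportedFlow-route p (e , es , refl , w , source , _) simple@(_ ∷ heads!) y (_ , y-flow , y-outflow) y-supp x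
    with x ∈? p
  ... | no  x∉ = trans (y-supp x x∉) (sym (𝓘-∉ x∉))
  ... | yes x∈ = begin
    y x               ≡⟨ supportedFlow-constant e es w heads! tails! y y-flow y-supp x∈ ⟩
    y e               ≡⟨ maskedSum-single _ y e (isSourceᵇ-complete source) only-e ⟨
    sourceOutflow G y ≡⟨ y-outflow ⟩
    1ℚ                ≡⟨ 𝓘-unique-∈ (Unique.map⁻ tails!) x∈ ⟨
    𝓘 G p x           ∎
    where
      open ≡-Reasoning
      tails! : Unique (map tail p)
      tails! = simpleRoute-tails! e es w simple
      only-e : ∀ f → f ≢ e → isSourceᵇ G (tail f) ≡ true → y f ≡ 0ℚ
      only-e f f≢e f-source with f ∈? p
      ... | yes f∈ = ⊥-elim (f≢e (walk-source-first e es w f∈ (isSourceᵇ-sound f-source)))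
      ... | no  f∉ = y-supp f f∉

  simpleRoute-vertex : ∀ p → IsRoute G p → SimpleRoute G p → IsVertex G (𝓕₁ G) (𝓘 G p)
  simpleRoute-vertex p isRoute simple = route-𝓕₁ p isRoute , same
    where
      same : ∀ y z λ' → 𝓕₁ G y → 𝓕₁ G z → 0ℚ < λ' → λ' < 1ℚ →
        𝓘 G p ≗ (λ e → λ' * y e + (1ℚ - λ') * z e) → y ≗ z
      same y z λ' 𝓕y 𝓕z 0<λ λ<1 p≐yz f =
        trans (supportedFlow-route p isRoute simple y 𝓕y (λ f → proj₁ ∘ supp f) f)
              (sym (supportedFlow-route p isRoute simple z 𝓕z (λ f → proj₂ ∘ supp f) f))
        where
          supp : ∀ f → f ∉ p → y f ≡ 0ℚ × z f ≡ 0ℚ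
          supp f f∉ =
            convexCombination-≡0 0<λ λ<1 (proj₁ 𝓕y f) (proj₁ 𝓕z f) (trans (sym (p≐yz f)) (𝓘-∉ f∉))

  proportional⇒⊆ : ∀ {c} l l' → 0ℚ < c → 𝓘 G l ≗ (λ x → c * 𝓘 G l' x) →
    ∀ {x} → x ∈ l → x ∈ l'
  proportional⇒⊆ {c} l l' 0<c l∝l' {x} x∈l with x ∈? l'
  ... | yes x∈l' = x∈l'
  ... | no  x∉l' = ⊥-elim (<-irrefl (sym lx≡0) (∈⇒0<𝓘 x∈l))
    where
      lx≡0 : 𝓘 G l x ≡ 0ℚ
      lx≡0 = trans (l∝l' x) (trans (cong (c *_) (𝓘-∉ x∉l')) (*-zeroʳ c))

  proportional⇒⊇ : ∀ {c} l l' → 0ℚ < c → 𝓘 G l ≗ (λ x → c * 𝓘 G l' x) →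
    ∀ {x} → x ∈ l' → x ∈ l
  proportional⇒⊇ l l' 0<c l∝l' {x} x∈l' = 0<𝓘⇒∈ l (subst (0ℚ <_) (sym (l∝l' x)) (*-pos 0<c (∈⇒0<𝓘 x∈l')))

  𝓘-≗⇒⊆ : ∀ l l' → 𝓘 G l ≗ 𝓘 G l' → ∀ {x} → x ∈ l → x ∈ l'
  𝓘-≗⇒⊆ l l' l≗l' {x} x∈l = 0<𝓘⇒∈ l' (subst (0ℚ <_) (l≗l' x) (∈⇒0<𝓘 x∈l))

  elementaryRoute-injective : ∀ p p' → IsRoute G p → SimpleRoute G p → IsRoute G p' → SimpleRoute G p' →
    𝓘 G p ≗ 𝓘 G p' → p ≡ p'
  elementaryRoute-injective p p' (e , es , refl , w , source , _) simple (e' , es' , refl , w' , _ , _) simple' p≗p'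
    with walk-source-first e' es' w' (𝓘-≗⇒⊆ p p' p≗p' (here refl)) source
  ... | refl = cong (e ∷_) (simpleWalks-≡ e es es' w w'
                 (simpleRoute-tails! e es w simple) (simpleRoute-tails! e es' w' simple')
                 (𝓘-≗⇒⊆ p p' p≗p') (𝓘-≗⇒⊆ p' p (sym ∘ p≗p')))

  simpleCycle-injective : ∀ b b' → IsSimpleCycle b → IsSimpleCycle b' →
    PosMultiple G (𝓘 G b) (𝓘 G b') → RotEq G b b'
  simpleCycle-injective b@(e ∷ es) b'@(_ ∷ _) (w , _ , tails!) (w' , closed' , tails!') (c , 0<c , b∝b')
    with xs , ys , b'≡xs++e∷ys ← ∈-∃++ (proportional⇒⊆ b b' 0<c b∝b' (here refl))
    = e ∷ ys , xs , cong (e ∷_) es≡ys++xs , b'≡xs++e∷ys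
    where
      rotation : b' ↭ e ∷ ys ++ xs
      rotation = subst (_↭ e ∷ ys ++ xs) (sym b'≡xs++e∷ys) (++-comm xs (e ∷ ys))
      rotated-walk : IsWalk G (e ∷ ys ++ xs)
      rotated-walk =
        proj₁ (closedWalk-rotate xs e ys (subst (IsWalk G) b'≡xs++e∷ys w') (subst IsClosed b'≡xs++e∷ys closed'))
      es≡ys++xs : es ≡ ys ++ xs
      es≡ys++xs = simpleWalks-≡ e es (ys ++ xs) w rotated-walk tails! (unique-resp-↭ (map⁺ tail rotation) tails!')
        (∈-resp-↭ rotation ∘ proportional⇒⊆ b b' 0<c b∝b')
        (proportional⇒⊇ b b' 0<c b∝b' ∘ ∈-resp-↭ (↭-sym rotation))

  -- Elementary trails

  module _ (ℛ : Framing G) where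
    open Framing ℛ

    private
      ∈-infix : ∀ {x : E G} {q p} xs ys → xs ++ (q ++ ys) ≡ p → x ∈ q → x ∈ p
      ∈-infix xs ys refl x∈q = ∈-++⁺ʳ xs (∈-++⁺ˡ x∈q)

      empty-power : ∀ k → concat (replicate k []) ≡ ([] {A = E G})
      empty-power zero    = refl
      empty-power (suc k) = empty-power k

      ∈-power : ∀ {x : E G} {b} k → x ∈ concat (replicate k b) → x ∈ b
      ∈-power {b = b} (suc k) x∈ with ∈-++⁻ b x∈
      ... | inj₁ x∈b = x∈b
      ... | inj₂ x∈bᵏ = ∈-power k x∈bᵏ

    simpleRoute-selfCompatible : ∀ p → Unique (map head p) → SelfCompatible G ℛ (route p)
    simpleRoute-selfCompatible p heads!
      (_ , _ , (xs , ys , p≡) , (xs' , ys' , p≡') , e₁ , e₂ , _ , _ , _ , e₁<e₂ , _ , _ , _ , refl , refl) =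
      inLt-irrefl (subst (inLt e₁) (sym e₁≡e₂) e₁<e₂)
      where
        e₁≡e₂ : e₁ ≡ e₂
        e₁≡e₂ = unique-map-injective head heads!
                  (∈-infix xs ys p≡ (here refl)) (∈-infix xs' ys' p≡' (here refl)) (inLt-same e₁<e₂)

    simpleBand-selfCompatible : ∀ b → Unique (map tail b) → SelfCompatible G ℛ (band b)
    simpleBand-selfCompatible b tails!
      (_ , _ , (k , xs , ys , bᵏ≡) , (k' , xs' , ys' , bᵏ'≡) , _ , _ , f₁ , f₂ , R , _ , f₁<f₂ , _ , _ , refl , refl) =
      outLt-irrefl (subst (outLt f₁) (sym f₁≡f₂) f₁<f₂)
      where
        last∈ : ∀ {e f} → f ∈ e ∷ R ++ [ f ]
        last∈ = there (∈-++⁺ʳ R (here refl))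
        f₁≡f₂ : f₁ ≡ f₂
        f₁≡f₂ = unique-map-injective tail tails!
                  (∈-power k' (∈-infix xs' ys' bᵏ'≡ last∈)) (∈-power k (∈-infix xs ys bᵏ≡ last∈)) (outLt-same f₁<f₂)

    simpleCycle⇒band : ∀ b → IsSimpleCycle b → SelfCompatibleElementaryBand G ℛ b
    simpleCycle⇒band b@(e ∷ es) (w , closed , tails!) =
      (e , es , refl , w , closed , not-power) , tails! , simpleBand-selfCompatible b tails!
      where
        not-power : ¬ (Σ (List (E G)) λ q → Σ ℕ λ k → (k ℕ.≥ 2) × (b ≡ concat (replicate k q)))
        not-power ([]    , k , _ , b≡[]ᵏ) with () ← trans b≡[]ᵏ (empty-power k)
        not-power (x ∷ q , 1 , ℕ.s≤s () , _)
        not-power (x ∷ q , suc (suc k) , _ , b≡qᵏ) with x∉ ∷ _ ← subst (Unique ∘ map tail) b≡qᵏ tails! =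
          All.lookup x∉ (∈-map⁺ tail (∈-++⁺ʳ q (here refl))) refl

    band⇒simpleCycle : ∀ b → SelfCompatibleElementaryBand G ℛ b → IsSimpleCycle b
    band⇒simpleCycle b ((e , es , refl , w , closed , _) , tails! , _) = w , closed , tails!

  -- 𝓕₁ G is FlowOfValue 1ℚ and RecCone𝓕₁ G is FlowOfValue 0ℚ, definitionally.
  FlowOfValue : ℚ → Vec G → Set
  FlowOfValue c F = (∀ e → 0ℚ ≤ F e) × IsFlow G F × (sourceOutflow G F ≡ c)

  IsFlow-linear : ∀ x y s → IsFlow G x → IsFlow G y → IsFlow G (λ e → x e + s * y e)
  IsFlow-linear x y s x-flow y-flow v internal = begin
    inflow G (λ e → x e + s * y e) v   ≡⟨ maskedSum-linear _ x y s ⟩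
    inflow G x v + s * inflow G y v    ≡⟨ cong₂ (λ a b → a + s * b) (x-flow v internal) (y-flow v internal) ⟩
    outflow G x v + s * outflow G y v  ≡⟨ maskedSum-linear _ x y s ⟨
    outflow G (λ e → x e + s * y e) v  ∎
    where open ≡-Reasoning

  flowOfValue-perturb : ∀ {c} x w s → FlowOfValue c x → IsFlow G w → sourceOutflow G w ≡ 0ℚ →
    (∀ e → 0ℚ ≤ x e + s * w e) → FlowOfValue c (λ e → x e + s * w e)
  flowOfValue-perturb {c} x w s (_ , x-flow , x-value) w-flow w-value 0≤x+sw =
    0≤x+sw , IsFlow-linear x w s x-flow w-flow , (begin
      sourceOutflow G (λ e → x e + s * w e)      ≡⟨ maskedSum-linear _ x w s ⟩
      sourceOutflow G x + s * sourceOutflow G w  ≡⟨ cong₂ (λ a b → a + s * b) x-value w-value ⟩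
      c + s * 0ℚ                                 ≡⟨ cong (c +_) (*-zeroʳ s) ⟩
      c + 0ℚ                                     ≡⟨ +-identityʳ c ⟩
      c                                          ∎)
    where open ≡-Reasoning

  bottleneck : Vec G → E G → List (E G) → E G
  bottleneck = argmin

  bottleneck-∈ : ∀ x e es → bottleneck x e es ∈ e ∷ es
  bottleneck-∈ x e es = argmin-all x (here refl) (All.tabulate there)

  bottleneck-≤ : ∀ x e es {f} → f ∈ e ∷ es → x (bottleneck x e es) ≤ x f
  bottleneck-≤ x e es (here refl) = f[argmin]≤f[⊤] {f = x} e es
  bottleneck-≤ x e es (there f∈)  = All.lookup (f[argmin]≤f[xs] {f = x} e es) f∈

  scaled-𝓘≤ : ∀ (x : Vec G) t l → Unique l → (∀ e → 0ℚ ≤ x e) → (∀ {f} → f ∈ l → t ≤ x f) →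
    ∀ e → t * 𝓘 G l e ≤ x e
  scaled-𝓘≤ x t l l! 0≤x t≤x e with e ∈? l
  ... | yes e∈ = subst (_≤ x e) (sym (trans (cong (t *_) (𝓘-unique-∈ {e} {l} l! e∈)) (*-identityʳ t))) (t≤x e∈)
  ... | no  e∉ = subst (_≤ x e) (sym (trans (cong (t *_) (𝓘-∉ {e} {l} e∉)) (*-zeroʳ t)))      (0≤x e)

  module Backtrack (Pos : E G → Set) (Stop : V G → Set)
                   (extend : ∀ f → Pos f → Stop (tail f) ⊎ ∃ λ e → Pos e × head e ≡ tail f) where

    SimplePositiveWalk : List (E G) → Set
    SimplePositiveWalk l = IsWalk G l × Unique (map tail l) × All Pos l

    PathTo : E G → Set
    PathTo e₀ = Σ (E G) λ f → Σ (List (E G)) λ rest →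
      SimplePositiveWalk (f ∷ rest) × lastOf G f rest ≡ e₀ × Stop (tail f)

    PositiveCycle : Set
    PositiveCycle = Σ (List (E G)) λ b → IsSimpleCycle b × All Pos b

    private
      close : ∀ e pre g post → IsWalk G (e ∷ pre ++ g ∷ post) → Unique (map tail (pre ++ g ∷ post)) →
        All Pos (e ∷ pre ++ g ∷ post) → tail e ≡ tail g → PositiveCycle
      close e pre g post w tails! pos tail-e≡tail-g =
        e ∷ pre , (linked-++⁻ˡ (e ∷ pre) w , trans (walk-split e pre g post w) (sym tail-e≡tail-g) , tails-pre!) ,
        All.++⁻ˡ (e ∷ pre) pos
        where
          tails!′ : Unique (map tail pre ++ map tail (g ∷ post))
          tails!′ = subst Unique (List.map-++ tail pre (g ∷ post)) tails!
          tails-pre! : Unique (map tail (e ∷ pre))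
          tails-pre! =
            All.¬Any⇒All¬ _ (unique-middle (map tail pre) tails!′ ∘ subst (_∈ map tail pre) tail-e≡tail-g)
            ∷ unique-++⁻ˡ (map tail pre) tails!′

      grow : ∀ e₀ k f rest → SimplePositiveWalk (f ∷ rest) → lastOf G f rest ≡ e₀ →
        length (f ∷ rest) ℕ.+ k ≡ suc nV → PathTo e₀ ⊎ PositiveCycle
      grow e₀ zero f rest (_ , tails! , _) _ length≡ =
        ⊥-elim (ℕ.n≮n nV (subst (ℕ._≤ nV) length≡suc-nV length≤nV))
        where
          length≡suc-nV : length (f ∷ rest) ≡ suc nV
          length≡suc-nV = trans (sym (ℕ.+-identityʳ _)) length≡
          length≤nV : length (f ∷ rest) ℕ.≤ nV
          length≤nV =
            subst (ℕ._≤ nV) (List.length-map tail (f ∷ rest)) (unique-length≤ (map tail (f ∷ rest)) tails!)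
      grow e₀ (suc k) f rest simple@(w , tails! , pos) last≡e₀ length≡ with extend f (All.head pos)
      ... | inj₁ stop = inj₁ (f , rest , simple , last≡e₀ , stop)
      ... | inj₂ (e , pos-e , e→f) with tail e ∈ᵥ? map tail (f ∷ rest)
      ...   | no  new = grow e₀ k e (f ∷ rest) (e→f ∷ w , All.¬Any⇒All¬ _ new ∷ tails! , pos-e ∷ pos) last≡e₀
                          (trans (sym (ℕ.+-suc (length (f ∷ rest)) k)) length≡)
      ...   | yes seen with g , g∈ , tail-e≡tail-g ← ∈-map⁻ tail seen with pre , post , f∷rest≡ ← ∈-∃++ g∈ =
        inj₂ (close e pre g post (subst (λ l → IsWalk G (e ∷ l)) f∷rest≡ (e→f ∷ w))
                                 (subst (Unique ∘ map tail) f∷rest≡ tails!)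
                                 (subst (All Pos ∘ (e ∷_)) f∷rest≡ (pos-e ∷ pos))
                                 tail-e≡tail-g)

    backtrack : ∀ e₀ → Pos e₀ → PathTo e₀ ⊎ PositiveCycle
    backtrack e₀ pos-e₀ = grow e₀ nV e₀ [] ([-] , [] ∷ [] , pos-e₀ ∷ []) refl refl

-- Vertices of 𝓕₁

-- A forward search in G is a backward search in the opposite graph.
opposite : Graph → Graph
opposite G = record { nV = Graph.nV G ; nE = Graph.nE G ; tail = Graph.head G ; head = Graph.tail G }

module Vertices (G : Graph) where
  open Graph G
  open WalksAndFlows G
  private
    module Opposite = WalksAndFlows (opposite G)

  lastOf-opposite : ∀ e es → lastOf (opposite G) e es ≡ lastOf G e es
  lastOf-opposite e []       = refl
  lastOf-opposite e (f ∷ fs) = lastOf-opposite f fs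

  private
    reverse-walk : ∀ x xs done → IsWalk (opposite G) (x ∷ xs) → IsWalk G (x ∷ done) →
      Σ (E G) λ e → Σ (List (E G)) λ es → (xs ʳ++ (x ∷ done) ≡ e ∷ es) × IsWalk G (e ∷ es) ×
        (e ≡ lastOf G x xs) × (lastOf G e es ≡ lastOf G x done)
    reverse-walk x []       done _           w = x , done , refl , w , refl , refl
    reverse-walk x (y ∷ ys) done (x←y ∷ w°) w = reverse-walk y ys (x ∷ done) w° (sym x←y ∷ w)

  reverse-oppositeWalk : ∀ {P : E G → Set} f fs → IsWalk (opposite G) (f ∷ fs) →
    Unique (map head (f ∷ fs)) → All P (f ∷ fs) →
    Σ (E G) λ e → Σ (List (E G)) λ es → IsWalk G (e ∷ es) × Unique (map head (e ∷ es)) × All P (e ∷ es) ×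
      (e ≡ lastOf (opposite G) f fs) × (lastOf G e es ≡ f)
  reverse-oppositeWalk {P} f fs w° heads! all-P
    with e , es , reversed , w , e≡last , last≡f ← reverse-walk f fs [] w° [-] =
    e , es , w ,
    subst (Unique ∘ map head) reversed (unique-resp-↭ (map⁺ head reversal) heads!) ,
    subst (All P) reversed (All-resp-↭ reversal all-P) ,
    trans e≡last (sym (lastOf-opposite f fs)) , last≡f
    where
      reversal : f ∷ fs ↭ fs ʳ++ [ f ]
      reversal = ↭-trans (∷↭∷ʳ f fs) (++↭ʳ++ fs [ f ])

  vertex-rigid : ∀ x → IsVertex G (𝓕₁ G) x → ∀ w → IsFlow G w → sourceOutflow G w ≡ 0ℚ →
    ∀ t → 0ℚ < t → (∀ e → 0ℚ ≤ x e + t * w e) → (∀ e → 0ℚ ≤ x e + (- t) * w e) → ∀ e → w e ≡ 0ℚ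
  vertex-rigid x (x∈𝓕₁ , extreme) w w-flow w-value t 0<t 0≤x+tw 0≤x-tw e = pos*q≡0⇒q≡0 (*-pos 0<2 0<t) (begin
    (2ℚ * t) * w e
      ≡⟨ solve 3 (λ x t w → (con 2ℚ :* t) :* w := (x :+ t :* w) :- (x :+ (:- t) :* w)) refl (x e) t (w e) ⟩
    (x e + t * w e) - (x e + (- t) * w e)
      ≡⟨ cong (λ z → z - (x e + (- t) * w e)) (x+tw≗x-tw e) ⟩
    (x e + (- t) * w e) - (x e + (- t) * w e)
      ≡⟨ +-inverseʳ (x e + (- t) * w e) ⟩
    0ℚ ∎)
    where
      open ≡-Reasoning
      2ℚ : ℚ
      2ℚ = 1ℚ + 1ℚ
      0<2 : 0ℚ < 2ℚ
      0<2 = from-yes (0ℚ <? 2ℚ)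
      midpoint : ∀ e → x e ≡ ½ * (x e + t * w e) + (1ℚ - ½) * (x e + (- t) * w e)
      midpoint e = solve 3 (λ x t w → x := con ½ :* (x :+ t :* w) :+ (con 1ℚ :- con ½) :* (x :+ (:- t) :* w))
                     refl (x e) t (w e)
      x+tw≗x-tw : (λ e → x e + t * w e) ≗ (λ e → x e + (- t) * w e)
      x+tw≗x-tw = extreme _ _ ½ (flowOfValue-perturb x w t x∈𝓕₁ w-flow w-value 0≤x+tw)
                                (flowOfValue-perturb x w (- t) x∈𝓕₁ w-flow w-value 0≤x-tw)
                                (positive⁻¹ ½) ½<1 midpoint

  vertex-acyclic : ∀ x → IsVertex G (𝓕₁ G) x → ∀ b → IsSimpleCycle b → ¬ All (λ e → 0ℚ < x e) b
  vertex-acyclic x vertex b@(g ∷ gs) (w , closed , tails!) 0<x =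
    <-irrefl (sym (trans (sym (𝓘-unique-∈ b! (here refl))) b-vanishes)) 0<1
    where
      b! : Unique b
      b! = Unique.map⁻ tails!
      t : ℚ
      t = x (bottleneck x g gs)
      0<t : 0ℚ < t
      0<t = All.lookup 0<x (bottleneck-∈ x g gs)
      b-recCone : RecCone𝓕₁ G (𝓘 G b)
      b-recCone = closedWalk-recCone g gs w closed
      0≤x : ∀ e → 0ℚ ≤ x e
      0≤x = proj₁ (proj₁ vertex)
      b-vanishes : 𝓘 G b g ≡ 0ℚ
      b-vanishes = vertex-rigid x vertex (𝓘 G b) (proj₁ (proj₂ b-recCone)) (proj₂ (proj₂ b-recCone)) t 0<t
        (λ e → +-nonNeg (0≤x e) (*-nonNeg (<⇒≤ 0<t) (0≤𝓘 b e)))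
        (λ e → subst (0ℚ ≤_) (sym (p+-q*r≡p-q*r (x e) t (𝓘 G b e)))
                 (p≤q⇒0≤q-p (scaled-𝓘≤ x t b b! 0≤x (bottleneck-≤ x g gs) e)))
        g

  vertex-≗-positiveRoute : ∀ x → IsVertex G (𝓕₁ G) x → ∀ p → IsRoute G p → SimpleRoute G p →
    All (λ e → 0ℚ < x e) p → 𝓘 G p ≗ x
  vertex-≗-positiveRoute x vertex p isRoute@(e , es , refl , walk , source , _) simple 0<x f = begin
    𝓘 G p f   ≡⟨ solve 2 (λ x i → i := x :- (x :+ (:- con 1ℚ) :* i)) refl (x f) (𝓘 G p f) ⟩
    x f - w f ≡⟨ cong (λ z → x f - z) wf≡0 ⟩
    x f - 0ℚ  ≡⟨ +-identityʳ (x f) ⟩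
    x f       ∎
    where
      open ≡-Reasoning
      x∈𝓕₁ : 𝓕₁ G x
      x∈𝓕₁ = proj₁ vertex
      0≤x : ∀ e → 0ℚ ≤ x e
      0≤x = proj₁ x∈𝓕₁
      p∈𝓕₁ : 𝓕₁ G (𝓘 G p)
      p∈𝓕₁ = route-𝓕₁ p isRoute
      w : Vec G
      w f = x f + (- 1ℚ) * 𝓘 G p f
      w-flow : IsFlow G w
      w-flow = IsFlow-linear x (𝓘 G p) (- 1ℚ) (proj₁ (proj₂ x∈𝓕₁)) (proj₁ (proj₂ p∈𝓕₁))
      w-value : sourceOutflow G w ≡ 0ℚ
      w-value = trans (maskedSum-linear _ x (𝓘 G p) (- 1ℚ))
                      (cong₂ (λ a b → a + (- 1ℚ) * b) (proj₂ (proj₂ x∈𝓕₁)) (proj₂ (proj₂ p∈𝓕₁)))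
      t : ℚ
      t = x (bottleneck x e es)
      0<t : 0ℚ < t
      0<t = All.lookup 0<x (bottleneck-∈ x e es)
      t≤1 : t ≤ 1ℚ
      t≤1 = ≤-trans (bottleneck-≤ x e es (here refl))
              (subst (x e ≤_) (proj₂ (proj₂ x∈𝓕₁)) (term≤maskedSum _ x e (isSourceᵇ-complete source) 0≤x))
      ti≤x : ∀ f → t * 𝓘 G p f ≤ x f
      ti≤x = scaled-𝓘≤ x t p (Unique.map⁻ (simpleRoute-tails! e es walk simple)) 0≤x (bottleneck-≤ x e es)
      0≤x±tw : ∀ f → 0ℚ ≤ x f + t * w f × 0ℚ ≤ x f + (- t) * w f
      0≤x±tw f = 0≤a±t[a-b] (0≤x f) (0≤𝓘 p f) (<⇒≤ 0<t) t≤1 (ti≤x f)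
      wf≡0 : w f ≡ 0ℚ
      wf≡0 = vertex-rigid x vertex w w-flow w-value t 0<t (proj₁ ∘ 0≤x±tw) (proj₂ ∘ 0≤x±tw) f

  module _ (x : Vec G) (vertex : IsVertex G (𝓕₁ G) x) where
    private
      x∈𝓕₁ : 𝓕₁ G x
      x∈𝓕₁ = proj₁ vertex

      0≤x : ∀ e → 0ℚ ≤ x e
      0≤x = proj₁ x∈𝓕₁

      Pos : E G → Set
      Pos e = 0ℚ < x e

      positive-outEdge : ∀ f → Pos f → IsSink G (head f) ⊎ ∃ λ e → Pos e × tail e ≡ head f
      positive-outEdge f 0<xf with Fin.any? (λ e → tail e ≟ head f)
      ... | no  none      = inj₁ (λ e e-leaves → none (e , e-leaves))
      ... | yes (e , e-leaves) with maskedSum-pos _ x 0<outflow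
        where
          0<outflow : 0ℚ < outflow G x (head f)
          0<outflow = <-≤-trans 0<xf (≤-trans (term≤maskedSum _ x f (dec-true (head f ≟ head f) refl) 0≤x)
                        (≤-reflexive (proj₁ (proj₂ x∈𝓕₁) (head f) internal)))
            where
              internal : IsInternal G (head f)
              internal = (λ source → source f refl) , (λ sink → sink e e-leaves)
      ... | e' , e'-leaves , 0<xe' = inj₂ (e' , 0<xe' , does-true⇒ (tail e' ≟ head f) e'-leaves)

      open Opposite.Backtrack Pos (IsSink G) positive-outEdge

      no-positive-cycle : ¬ PositiveCycle
      no-positive-cycle (g ∷ gs , (w° , closed° , heads!°) , 0<x°)
        with e , es , w , heads! , 0<x , e≡last , last≡g ← reverse-oppositeWalk g gs w° heads!° 0<x° =
        vertex-acyclic x vertex (e ∷ es) (w , closed , unique-resp-↭ (closedWalk-heads↭tails e es w closed) heads!) 0<x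
        where
          closed : IsClosed (e ∷ es)
          closed = trans (cong head last≡g) (trans (sym closed°) (cong tail (sym e≡last)))

    vertex-elementaryRoute : ∀ ℛ → Σ (List (E G)) λ p → ElementaryRoute G ℛ p × 𝓘 G p ≗ x
    vertex-elementaryRoute ℛ
      with e₀ , e₀-source , 0<xe₀ ← maskedSum-pos _ x (subst (0ℚ <_) (sym (proj₂ (proj₂ x∈𝓕₁))) 0<1)
      with backtrack e₀ 0<xe₀
    ... | inj₂ cycle = ⊥-elim (no-positive-cycle cycle)
    ... | inj₁ (f , rest , (w° , heads!° , 0<x°) , last≡e₀ , sink)
      with e , es , w , heads! , 0<x , e≡last , last≡f ← reverse-oppositeWalk f rest w° heads!° 0<x° =
      p , (isRoute , simple , simpleRoute-selfCompatible ℛ p heads!) , vertex-≗-positiveRoute x vertex p isRoute simple 0<x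
      where
        p : List (E G)
        p = e ∷ es
        source : IsSource G (tail e)
        source = subst (IsSource G ∘ tail) (sym (trans e≡last last≡e₀)) (isSourceᵇ-sound e₀-source)
        isRoute : IsRoute G p
        isRoute = e , es , refl , w , source , subst (IsSink G ∘ head) (sym last≡f) sink
        simple : SimpleRoute G p
        simple = All.tabulate (λ h∈ tail-e≡h → let a , _ , h≡ = ∈-map⁻ head h∈ in source a (sym (trans tail-e≡h h≡)))
                 ∷ heads!

-- Extremal rays of the recession cone

module ExtremalRays (G : Graph) where
  open Graph G
  open WalksAndFlows G
  open import Data.List.Membership.DecPropositional (_≟_ {nE}) using (_∈?_)

  posMultiple-sym : ∀ {x y} → PosMultiple G x y → PosMultiple G y x
  posMultiple-sym {x} {y} (c , 0<c , x≗cy) = (1/ c) {{>-nonZero 0<c}} , 0<1/p 0<c ,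
    λ e → sym (trans (cong ((1/ c) {{>-nonZero 0<c}} *_) (x≗cy e)) (1/p*[p*q]≡q 0<c (y e)))

  posMultiple-trans : ∀ {x y z} → PosMultiple G x y → PosMultiple G y z → PosMultiple G x z
  posMultiple-trans {z = z} (c , 0<c , x≗cy) (c' , 0<c' , y≗c'z) = c * c' , *-pos 0<c 0<c' ,
    λ e → trans (x≗cy e) (trans (cong (c *_) (y≗c'z e)) (sym (*-assoc c c' (z e))))

  simpleCycle-nonempty : ∀ b → IsSimpleCycle b → ∃ λ g → g ∈ b
  simpleCycle-nonempty (g ∷ _) _ = g , here refl

  simpleCycle-recCone : ∀ b → IsSimpleCycle b → RecCone𝓕₁ G (𝓘 G b)
  simpleCycle-recCone (g ∷ gs) (w , closed , _) = closedWalk-recCone g gs w closed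

  record IsCone (K : Vec G → Set) : Set where
    field
      zero-∈   : K (λ _ → 0ℚ)
      +-closed : ∀ {x y} → K x → K y → K (λ e → x e + y e)
      *-closed : ∀ {c x} → 0ℚ ≤ c → K x → K (λ e → c * x e)
      resp-≗   : ∀ {x y} → x ≗ y → K x → K y

  ⊎-isCone : ∀ {K} (Q : Set) → IsCone K → IsCone (λ x → Q ⊎ K x)
  ⊎-isCone Q K-cone = record
    { zero-∈   = inj₂ zero-∈
    ; +-closed = λ { (inj₁ q) _ → inj₁ q
                   ; (inj₂ _) (inj₁ q) → inj₁ q
                   ; (inj₂ kx) (inj₂ ky) → inj₂ (+-closed kx ky) }
    ; *-closed = λ { 0≤c (inj₁ q) → inj₁ q ; 0≤c (inj₂ kx) → inj₂ (*-closed 0≤c kx) }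
    ; resp-≗   = λ { x≗y (inj₁ q) → inj₁ q ; x≗y (inj₂ kx) → inj₂ (resp-≗ x≗y kx) }
    }
    where open IsCone K-cone

  cone-sum : ∀ {K} → IsCone K → ∀ {m} (x : Fin m → Vec G) → (∀ l → K (x l)) →
    K (λ e → sumFin G (λ l → x l e))
  cone-sum K-cone {zero}  x x∈K = IsCone.zero-∈ K-cone
  cone-sum K-cone {suc m} x x∈K = IsCone.+-closed K-cone (x∈K zero) (cone-sum K-cone (x ∘ suc) (x∈K ∘ suc))

  support : Vec G → Subset nE
  support d = Vec.tabulate (λ e → does (0ℚ <? d e))

  ∈-support⁺ : ∀ d {e} → 0ℚ < d e → e Subset.∈ support d
  ∈-support⁺ d {e} 0<de = Vec.lookup⇒[]= e (support d) (trans (Vec.lookup∘tabulate _ e) (dec-true (0ℚ <? d e) 0<de))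

  ∈-support⁻ : ∀ d {e} → e Subset.∈ support d → 0ℚ < d e
  ∈-support⁻ d {e} e∈ = does-true⇒ (0ℚ <? d e) (trans (sym (Vec.lookup∘tabulate _ e)) (Vec.[]=⇒lookup e∈))

  recCone-positive-inEdge : ∀ d → RecCone𝓕₁ G d → ∀ f → 0ℚ < d f → ⊥ ⊎ ∃ λ e → 0ℚ < d e × head e ≡ tail f
  recCone-positive-inEdge d (0≤d , d-flow , d-value) f 0<df with maskedSum-pos _ d 0<inflow
    where
      ¬source : ¬ IsSource G (tail f)
      ¬source source = <-irrefl refl (<-≤-trans 0<df
        (subst (d f ≤_) d-value (term≤maskedSum _ d f (isSourceᵇ-complete source) 0≤d)))
      0<inflow : 0ℚ < inflow G d (tail f)
      0<inflow = <-≤-trans 0<df (≤-trans (term≤maskedSum _ d f (dec-true (tail f ≟ tail f) refl) 0≤d)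
                   (≤-reflexive (sym (d-flow (tail f) (¬source , λ sink → sink f refl)))))
  ... | e , e-enters , 0<de = inj₂ (e , 0<de , does-true⇒ (head e ≟ tail f) e-enters)

  recCone-positiveCycle : ∀ d → RecCone𝓕₁ G d → ∀ e → 0ℚ < d e →
    Σ (List (E G)) λ b → IsSimpleCycle b × All (λ e → 0ℚ < d e) b
  recCone-positiveCycle d d∈C e 0<de
    with Backtrack.backtrack (λ e → 0ℚ < d e) (λ _ → ⊥) (recCone-positive-inEdge d d∈C) e 0<de
  ... | inj₁ (_ , _ , _ , _ , ())
  ... | inj₂ cycle = cycle

  peel-cycle : ∀ d → RecCone𝓕₁ G d → ∀ b → IsSimpleCycle b → All (λ e → 0ℚ < d e) b →
    Σ ℚ λ ε → 0ℚ < ε × Σ (Vec G) λ d' →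
      RecCone𝓕₁ G d' × (∀ e → d' e ≤ d e) × (support d' Subset.⊂ support d) ×
      d ≗ (λ e → d' e + ε * 𝓘 G b e)
  peel-cycle d d∈C b@(g ∷ gs) b-cycle@(w , closed , tails!) 0<d =
    ε , 0<ε , d' , d'∈C , d'≤d , (d'⊆d , m , ∈-support⁺ d 0<ε , m∉d') , d≗d'+εb
    where
      m : E G
      m = bottleneck d g gs
      ε : ℚ
      ε = d m
      0<ε : 0ℚ < ε
      0<ε = All.lookup 0<d (bottleneck-∈ d g gs)
      b-recCone : RecCone𝓕₁ G (𝓘 G b)
      b-recCone = closedWalk-recCone g gs w closed
      d' : Vec G
      d' e = d e + (- ε) * 𝓘 G b e
      d'≡d-εb : ∀ e → d' e ≡ d e - ε * 𝓘 G b e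
      d'≡d-εb e = p+-q*r≡p-q*r (d e) ε (𝓘 G b e)
      εb≤d : ∀ e → ε * 𝓘 G b e ≤ d e
      εb≤d = scaled-𝓘≤ d ε b (Unique.map⁻ tails!) (proj₁ d∈C) (bottleneck-≤ d g gs)
      d'∈C : RecCone𝓕₁ G d'
      d'∈C = flowOfValue-perturb d (𝓘 G b) (- ε) d∈C (proj₁ (proj₂ b-recCone)) (proj₂ (proj₂ b-recCone))
        (λ e → subst (0ℚ ≤_) (sym (d'≡d-εb e)) (p≤q⇒0≤q-p (εb≤d e)))
      d'≤d : ∀ e → d' e ≤ d e
      d'≤d e = subst (_≤ d e) (sym (d'≡d-εb e)) (p-q≤p (*-nonNeg (<⇒≤ 0<ε) (0≤𝓘 b e)))
      d'⊆d : support d' Subset.⊆ support d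
      d'⊆d {e} e∈ = ∈-support⁺ d (<-≤-trans (∈-support⁻ d' e∈) (d'≤d e))
      m∉d' : m Subset.∉ support d'
      m∉d' m∈ = <-irrefl (sym d'm≡0) (∈-support⁻ d' m∈)
        where
          d'm≡0 : d' m ≡ 0ℚ
          d'm≡0 = begin
            d' m           ≡⟨ d'≡d-εb m ⟩
            ε - ε * 𝓘 G b m ≡⟨ cong (λ z → ε - ε * z) (𝓘-unique-∈ (Unique.map⁻ tails!) (bottleneck-∈ d g gs)) ⟩
            ε - ε * 1ℚ     ≡⟨ cong (λ z → ε - z) (*-identityʳ ε) ⟩
            ε - ε          ≡⟨ +-inverseʳ ε ⟩
            0ℚ             ∎
            where open ≡-Reasoning
      d≗d'+εb : d ≗ (λ e → d' e + ε * 𝓘 G b e)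
      d≗d'+εb e = solve 3 (λ d ε i → d := (d :+ (:- ε) :* i) :+ ε :* i) refl (d e) ε (𝓘 G b e)

  module _ {K : Vec G → Set} (K-cone : IsCone K) where
    open IsCone K-cone

    cycle-decomposition : ∀ d → RecCone𝓕₁ G d →
      (∀ b → IsSimpleCycle b → All (λ e → 0ℚ < d e) b → K (𝓘 G b)) → K d
    cycle-decomposition d d∈C cycles∈K = go d d∈C cycles∈K (ℕ.<-wellFounded _)
      where
        go : ∀ d → RecCone𝓕₁ G d → (∀ b → IsSimpleCycle b → All (λ e → 0ℚ < d e) b → K (𝓘 G b)) →
          Acc ℕ._<_ (Subset.∣ support d ∣) → K d
        go d d∈C cycles∈K (acc smaller) with Fin.any? (λ e → 0ℚ <? d e)
        ... | no none = resp-≗ (λ e → sym (≤-antisym (≮⇒≥ (none ∘ (e ,_))) (proj₁ d∈C e))) zero-∈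
        ... | yes (e , 0<de)
          with b , b-cycle , 0<d ← recCone-positiveCycle d d∈C e 0<de
          with ε , 0<ε , d' , d'∈C , d'≤d , d'⊂d , d≗d'+εb ← peel-cycle d d∈C b b-cycle 0<d =
          resp-≗ (sym ∘ d≗d'+εb) (+-closed (go d' d'∈C cycles'∈K (smaller (Subset.p⊂q⇒∣p∣<∣q∣ d'⊂d)))
                                            (*-closed (<⇒≤ 0<ε) (cycles∈K b b-cycle 0<d)))
          where
            cycles'∈K : ∀ b → IsSimpleCycle b → All (λ e → 0ℚ < d' e) b → K (𝓘 G b)
            cycles'∈K b' b'-cycle 0<d' = cycles∈K b' b'-cycle (All.map (λ {e} 0<d'e → <-≤-trans 0<d'e (d'≤d e)) 0<d')

  isSimpleCycle? : ∀ b → Dec (IsSimpleCycle b)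
  isSimpleCycle? []       = no λ ()
  isSimpleCycle? (e ∷ es) = linked? (λ a b → head a ≟ tail b) (e ∷ es)
                     ×-dec (head (lastOf G e es) ≟ tail e)
                     ×-dec unique? _≟_ (map tail (e ∷ es))

  simpleCycle-length≤ : ∀ b → IsSimpleCycle b → length b ℕ.≤ nV
  simpleCycle-length≤ b@(_ ∷ _) (_ , _ , tails!) = subst (ℕ._≤ nV) (List.length-map tail b) (unique-length≤ _ tails!)

  SameIncidence : List (E G) → List (E G) → Set
  SameIncidence b b' = 𝓘 G b ≗ 𝓘 G b'

  incidenceDecSetoid : DecSetoid 0ℓ 0ℓ
  incidenceDecSetoid = record
    { Carrier = List (E G)
    ; _≈_ = SameIncidence
    ; isDecEquivalence = record
      { isEquivalence = record
        { refl  = λ _ → refl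
        ; sym   = λ b≈b' e → sym (b≈b' e)
        ; trans = λ b≈b' b'≈b″ e → trans (b≈b' e) (b'≈b″ e)
        }
      ; _≟_ = λ b b' → Fin.all? (λ e → 𝓘 G b e ℚ.≟ 𝓘 G b' e)
      }
    }
  open DecSetoid incidenceDecSetoid using () renaming (_≟_ to _≟ᵢ_)

  -- Deduplication is what makes the family minimal: a repeated generator would be redundant.
  simpleCycles : List (List (E G))
  simpleCycles = deduplicate _≟ᵢ_ (filter isSimpleCycle? (listsUpTo nV))

  cycleCount : ℕ
  cycleCount = length simpleCycles

  cycle : Fin cycleCount → List (E G)
  cycle = List.lookup simpleCycles

  cycleVector : Fin cycleCount → Vec G
  cycleVector i = 𝓘 G (cycle i)

  cycle-simple : ∀ i → IsSimpleCycle (cycle i)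
  cycle-simple i = All.lookup (All.deduplicate⁺ _≟ᵢ_ (All.all-filter isSimpleCycle? (listsUpTo nV))) (∈-lookup i)

  cycleVector-complete : ∀ b → IsSimpleCycle b → Σ (Fin cycleCount) λ i → 𝓘 G b ≗ cycleVector i
  cycleVector-complete b b-cycle = Any.index found , lookup-index found
    where
      listed : b ∈ listsUpTo nV
      listed = ∈-listsUpTo nV b (simpleCycle-length≤ b b-cycle)
      found : Any (SameIncidence b) simpleCycles
      found = Any.deduplicate⁺ _≟ᵢ_ (λ b″≈b' b≈b' e → trans (b≈b' e) (sym (b″≈b' e)))
                (Any.map (λ b≡b' e → cong (λ l → 𝓘 G l e) b≡b') (∈-filter⁺ isSimpleCycle? listed b-cycle))

  cycleVector-injective : ∀ i j → cycleVector i ≗ cycleVector j → i ≡ j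
  cycleVector-injective = allPairs-lookup-injective (λ b≈b' e → sym (b≈b' e))
    (deduplicate-! incidenceDecSetoid (filter isSimpleCycle? (listsUpTo nV)))

  Combination : ∀ {k} → (Fin k → Vec G) → (Fin k → Bool) → Vec G → Set
  Combination {k} S keep d = Σ (Fin k → ℚ) λ c → (∀ i → 0ℚ ≤ c i) × (∀ i → keep i ≡ false → c i ≡ 0ℚ) ×
    d ≗ (λ e → sumFin G (λ i → c i * S i e))

  module _ {k} (S : Fin k → Vec G) (keep : Fin k → Bool) where

    combination-isCone : IsCone (Combination S keep)
    combination-isCone = record
      { zero-∈   = (λ _ → 0ℚ) , (λ _ → ≤-refl) , (λ _ _ → refl) , (λ e → sym (sum-zero (λ i → *-zeroˡ (S i e))))
      ; +-closed = λ { (c , 0≤c , c-off , x≗) (c' , 0≤c' , c'-off , y≗) →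
          (λ i → c i + c' i) , (λ i → +-nonNeg (0≤c i) (0≤c' i)) ,
          (λ i off → trans (cong₂ _+_ (c-off i off) (c'-off i off)) (+-identityˡ 0ℚ)) ,
          (λ e → trans (cong₂ _+_ (x≗ e) (y≗ e)) (sym (trans (sum-cong (λ i → *-distribʳ-+ (S i e) (c i) (c' i)))
                   (sum-+ (λ i → c i * S i e) (λ i → c' i * S i e))))) }
      ; *-closed = λ { {a} 0≤a (c , 0≤c , c-off , x≗) →
          (λ i → a * c i) , (λ i → *-nonNeg 0≤a (0≤c i)) ,
          (λ i off → trans (cong (a *_) (c-off i off)) (*-zeroʳ a)) ,
          (λ e → trans (cong (a *_) (x≗ e))
                   (sym (trans (sum-cong (λ i → *-assoc a (c i) (S i e))) (sum-* a (λ i → c i * S i e))))) }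
      ; resp-≗   = λ { x≗y (c , 0≤c , c-off , x≗) → c , 0≤c , c-off , (λ e → trans (sym (x≗y e)) (x≗ e)) }
      }

    generator-combination : ∀ i a → keep i ≡ true → 0ℚ ≤ a → Combination S keep (λ e → a * S i e)
    generator-combination i a kept 0≤a = c , 0≤c , c-off , λ e →
      sym (trans (sum-single i (λ j j≢i → c-elsewhere j≢i (S j e))) (cong (_* S i e) c-here))
      where
        c : Fin k → ℚ
        c j = if does (i ≟ j) then a else 0ℚ
        0≤c : ∀ j → 0ℚ ≤ c j
        0≤c j with i ≟ j
        ... | yes _ = 0≤a
        ... | no  _ = ≤-refl
        c-off : ∀ j → keep j ≡ false → c j ≡ 0ℚ
        c-off j dropped with i ≟ j
        ... | yes refl with () ← trans (sym kept) dropped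
        ... | no  _    = refl
        c-here : c i ≡ a
        c-here with i ≟ i
        ... | yes _   = refl
        ... | no  i≢i = ⊥-elim (i≢i refl)
        c-elsewhere : ∀ {j} → j ≢ i → ∀ s → c j * s ≡ 0ℚ
        c-elsewhere {j} j≢i s with i ≟ j
        ... | yes i≡j = ⊥-elim (j≢i (sym i≡j))
        ... | no  _   = *-zeroˡ s

  module _ {k} (S : Fin k → Vec G) (0≤S : ∀ i e → 0ℚ ≤ S i e) (c : Fin k → ℚ) (0≤c : ∀ i → 0ℚ ≤ c i)
           {d : Vec G} (d≗ : d ≗ (λ e → sumFin G (λ i → c i * S i e))) where

    combination-support : ∀ l e → 0ℚ < c l → d e ≡ 0ℚ → S l e ≡ 0ℚ
    combination-support l e 0<cl de≡0 = pos*q≡0⇒q≡0 0<cl (≤-antisym cSₗ≤0 (*-nonNeg (0≤c l) (0≤S l e)))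
      where
        cSₗ≤0 : c l * S l e ≤ 0ℚ
        cSₗ≤0 = subst (c l * S l e ≤_) (trans (sym (d≗ e)) de≡0) (term≤sum (λ i → *-nonNeg (0≤c i) (0≤S i e)) l)

    combination-pos : ∀ e → 0ℚ < d e → Σ (Fin k) λ l → 0ℚ < c l × 0ℚ < S l e
    combination-pos e 0<de with l , 0<cS ← sum-pos⇒term-pos (subst (0ℚ <_) (d≗ e) 0<de) =
      l , pos-factorˡ (0≤S l e) 0<cS , pos-factorʳ (0≤c l) 0<cS

  supportedOnCycle-multiple : ∀ g gs → IsSimpleCycle (g ∷ gs) → ∀ y → RecCone𝓕₁ G y →
    (∀ e → e ∉ g ∷ gs → y e ≡ 0ℚ) → y ≗ (λ e → y g * 𝓘 G (g ∷ gs) e)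
  supportedOnCycle-multiple g gs (w , closed , tails!) y (_ , y-flow , _) y-supp e with e ∈? g ∷ gs
  ... | yes e∈ = trans (supportedFlow-constant g gs w heads! tails! y y-flow y-supp e∈)
                       (sym (trans (cong (y g *_) (𝓘-unique-∈ (Unique.map⁻ tails!) e∈)) (*-identityʳ (y g))))
    where heads! = unique-resp-↭ (↭-sym (closedWalk-heads↭tails g gs w closed)) tails!
  ... | no  e∉ = trans (y-supp e e∉) (sym (trans (cong (y g *_) (𝓘-∉ e∉)) (*-zeroʳ (y g))))

  nestedSimpleCycles-≗ : ∀ b b' → IsSimpleCycle b → IsSimpleCycle b' → (∀ e → e ∉ b → 𝓘 G b' e ≡ 0ℚ) →
    𝓘 G b' ≗ 𝓘 G b
  nestedSimpleCycles-≗ b@(g ∷ gs) b'@(h ∷ hs) b-cycle@(_ , _ , tails!) b'-cycle@(w' , closed' , tails!') b'⊆b e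
    with h ∈? b
  ... | no  h∉b = ⊥-elim (<-irrefl (sym (b'⊆b h h∉b)) (∈⇒0<𝓘 {l = b'} (here refl)))
  ... | yes h∈b = trans (b'≗b'g·b e) (trans (cong (_* 𝓘 G b e) b'g≡1) (*-identityˡ _))
    where
      b'≗b'g·b = supportedOnCycle-multiple g gs b-cycle (𝓘 G b') (closedWalk-recCone h hs w' closed') b'⊆b
      b'g≡1 : 𝓘 G b' g ≡ 1ℚ
      b'g≡1 = begin
        𝓘 G b' g            ≡⟨ *-identityʳ _ ⟨
        𝓘 G b' g * 1ℚ       ≡⟨ cong (𝓘 G b' g *_) (𝓘-unique-∈ (Unique.map⁻ tails!) h∈b) ⟨
        𝓘 G b' g * 𝓘 G b h  ≡⟨ b'≗b'g·b h ⟨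
        𝓘 G b' h            ≡⟨ 𝓘-unique-∈ (Unique.map⁻ tails!') (here refl) ⟩
        1ℚ                  ∎
        where open ≡-Reasoning

  0≤cycleVector : ∀ i e → 0ℚ ≤ cycleVector i e
  0≤cycleVector i = 0≤𝓘 (cycle i)

  cycleVectors-generate : GeneratesUsing G (RecCone𝓕₁ G) cycleVector (λ _ → true)
  cycleVectors-generate d d∈C = cycle-decomposition all-cone d d∈C cycles∈K
    where
      all-cone : IsCone (Combination cycleVector (λ _ → true))
      all-cone = combination-isCone cycleVector (λ _ → true)
      cycles∈K : ∀ b → IsSimpleCycle b → All (λ e → 0ℚ < d e) b →
        Combination cycleVector (λ _ → true) (𝓘 G b)
      cycles∈K b b-cycle _ = IsCone.resp-≗ all-cone (λ e → trans (*-identityˡ (cycleVector i e)) (sym (b≗i e)))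
                               (generator-combination cycleVector (λ _ → true) i 1ℚ refl (<⇒≤ 0<1))
        where
          i : Fin cycleCount
          i = proj₁ (cycleVector-complete b b-cycle)
          b≗i : 𝓘 G b ≗ cycleVector i
          b≗i = proj₂ (cycleVector-complete b b-cycle)

  cycleVectors-independent : ∀ keep i → keep i ≡ false → ¬ Combination cycleVector keep (cycleVector i)
  cycleVectors-independent keep i dropped (c , 0≤c , c-off , i≗) =
    <-irrefl (sym (c-off i dropped)) (subst (λ j → 0ℚ < c j) l≡i 0<cₗ)
    where
      g : E G
      g = proj₁ (simpleCycle-nonempty (cycle i) (cycle-simple i))
      found : Σ (Fin cycleCount) λ l → 0ℚ < c l × 0ℚ < cycleVector l g
      found = combination-pos cycleVector 0≤cycleVector c 0≤c i≗ g
                (∈⇒0<𝓘 (proj₂ (simpleCycle-nonempty (cycle i) (cycle-simple i))))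
      l : Fin cycleCount
      l = proj₁ found
      0<cₗ : 0ℚ < c l
      0<cₗ = proj₁ (proj₂ found)
      l≡i : l ≡ i
      l≡i = cycleVector-injective l i (nestedSimpleCycles-≗ (cycle i) (cycle l) (cycle-simple i) (cycle-simple l)
              (λ e e∉ → combination-support cycleVector 0≤cycleVector c 0≤c i≗ l e 0<cₗ (𝓘-∉ e∉)))

  simpleCycle-extremalRay : ∀ b → IsSimpleCycle b → IsExtremalRay G (RecCone𝓕₁ G) (𝓘 G b)
  simpleCycle-extremalRay b b-cycle =
    cycleCount , cycleVector ,
    ((λ i → simpleCycle-recCone (cycle i) (cycle-simple i)) , cycleVectors-generate ,
     λ keep (i , dropped) generates → cycleVectors-independent keep i dropped
       (generates (cycleVector i) (simpleCycle-recCone (cycle i) (cycle-simple i)))) ,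
    proj₁ found , 1ℚ , 0<1 , λ e → trans (proj₂ found e) (sym (*-identityˡ (cycleVector (proj₁ found) e)))
    where
      found : Σ (Fin cycleCount) λ i → 𝓘 G b ≗ cycleVector i
      found = cycleVector-complete b b-cycle

  allBut : ∀ {k} → Fin k → Fin k → Bool
  allBut i j = not (does (i ≟ j))

  allBut-self : ∀ {k} (i : Fin k) → allBut i i ≡ false
  allBut-self i = cong not (dec-true (i ≟ i) refl)

  allBut-other : ∀ {k} {i j : Fin k} → i ≢ j → allBut i j ≡ true
  allBut-other {i = i} {j} i≢j = cong not (dec-false (i ≟ j) i≢j)

  module _ {k} (S : Fin k → Vec G) (S∈C : ∀ i → RecCone𝓕₁ G (S i))
           (generates : GeneratesUsing G (RecCone𝓕₁ G) S (λ _ → true)) (i : Fin k) where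
    private
      others : Fin k → Bool
      others = allBut i

      0≤S : ∀ j e → 0ℚ ≤ S j e
      0≤S j = proj₁ (S∈C j)

    redundant-generator : Combination S others (S i) → GeneratesUsing G (RecCone𝓕₁ G) S others
    redundant-generator Sᵢ∈others d d∈C =
      resp-≗ (λ e → sym (d≗ e)) (cone-sum others-cone (λ j e → β j * S j e) term)
      where
        others-cone : IsCone (Combination S others)
        others-cone = combination-isCone S others
        open IsCone others-cone
        d-combination : Combination S (λ _ → true) d
        d-combination = generates d d∈C
        β : Fin k → ℚ
        β = proj₁ d-combination
        0≤β : ∀ j → 0ℚ ≤ β j
        0≤β = proj₁ (proj₂ d-combination)
        d≗ : d ≗ (λ e → sumFin G (λ j → β j * S j e))
        d≗ = proj₂ (proj₂ (proj₂ d-combination))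
        term : ∀ j → Combination S others (λ e → β j * S j e)
        term j with i ≟ j
        ... | yes refl = *-closed (0≤β i) Sᵢ∈others
        ... | no  i≢j  = generator-combination S others j (β j) (allBut-other i≢j) (0≤β j)

    CycleMultiple : Set
    CycleMultiple = Σ (List (E G)) λ b → IsSimpleCycle b × PosMultiple G (S i) (𝓘 G b)

    cycleMultiple-or-others : ∀ b → IsSimpleCycle b → CycleMultiple ⊎ Combination S others (𝓘 G b)
    cycleMultiple-or-others b@(g ∷ gs) b-cycle = decide (i ≟ l)
      where
        b-combination : Combination S (λ _ → true) (𝓘 G b)
        b-combination = generates (𝓘 G b) (simpleCycle-recCone b b-cycle)
        β : Fin k → ℚ
        β = proj₁ b-combination
        0≤β : ∀ j → 0ℚ ≤ β j
        0≤β = proj₁ (proj₂ b-combination)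
        b≗ : 𝓘 G b ≗ (λ e → sumFin G (λ j → β j * S j e))
        b≗ = proj₂ (proj₂ (proj₂ b-combination))
        found : Σ (Fin k) λ l → 0ℚ < β l × 0ℚ < S l g
        found = combination-pos S 0≤S β 0≤β b≗ g (∈⇒0<𝓘 {l = b} (here refl))
        l : Fin k
        l = proj₁ found
        Sₗ∝b : PosMultiple G (S l) (𝓘 G b)
        Sₗ∝b = S l g , proj₂ (proj₂ found) , supportedOnCycle-multiple g gs b-cycle (S l) (S∈C l)
          (λ e e∉ → combination-support S 0≤S β 0≤β b≗ l e (proj₁ (proj₂ found)) (𝓘-∉ e∉))
        decide : Dec (i ≡ l) → CycleMultiple ⊎ Combination S others (𝓘 G b)
        decide (yes i≡l) = inj₁ (b , b-cycle , subst (λ j → PosMultiple G (S j) (𝓘 G b)) (sym i≡l) Sₗ∝b)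
        decide (no  i≢l) = inj₂ (IsCone.resp-≗ (combination-isCone S others) (sym ∘ proj₂ (proj₂ b∝Sₗ))
          (generator-combination S others l (proj₁ b∝Sₗ) (allBut-other i≢l) (<⇒≤ (proj₁ (proj₂ b∝Sₗ)))))
          where
            b∝Sₗ : PosMultiple G (𝓘 G b) (S l)
            b∝Sₗ = posMultiple-sym Sₗ∝b

  extremalRay-simpleCycle : ∀ r → IsExtremalRay G (RecCone𝓕₁ G) r →
    Σ (List (E G)) λ b → IsSimpleCycle b × PosMultiple G (𝓘 G b) r
  extremalRay-simpleCycle r (k , S , (S∈C , generates , minimal) , i , r∝Sᵢ) = conclude (cycle-decomposition
    (⊎-isCone (CycleMultiple S S∈C generates i) (combination-isCone S (allBut i))) (S i) (S∈C i)
    (λ b b-cycle _ → cycleMultiple-or-others S S∈C generates i b b-cycle))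
    where
      conclude : CycleMultiple S S∈C generates i ⊎ Combination S (allBut i) (S i) →
        Σ (List (E G)) λ b → IsSimpleCycle b × PosMultiple G (𝓘 G b) r
      conclude (inj₁ (b , b-cycle , Sᵢ∝b)) = b , b-cycle , posMultiple-sym (posMultiple-trans r∝Sᵢ Sᵢ∝b)
      conclude (inj₂ Sᵢ-redundant) =
        ⊥-elim (minimal (allBut i) (i , allBut-self i) (redundant-generator S S∈C generates i Sᵢ-redundant))

theorem9p4 : (G : Graph) (ℛ : Framing G) →
    BijectionUpTo (ElementaryRoute G ℛ) _≡_ (IsVertex G (𝓕₁ G)) (_≐_ G) (𝓘 G)
    × BijectionUpTo (SelfCompatibleElementaryBand G ℛ) (RotEq G)
    (IsExtremalRay G (RecCone𝓕₁ G)) (PosMultiple G) (𝓘 G)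
theorem9p4 G ℛ = vertices , rays
  where
    open WalksAndFlows G
    open Vertices G
    open ExtremalRays G

    vertices : BijectionUpTo (ElementaryRoute G ℛ) _≡_ (IsVertex G (𝓕₁ G)) (_≐_ G) (𝓘 G)
    vertices = record
      { maps-to    = λ p (isRoute , simple , _) → simpleRoute-vertex p isRoute simple
      ; injective  = λ p p' (isRoute , simple , _) (isRoute' , simple' , _) →
                       elementaryRoute-injective p p' isRoute simple isRoute' simple'
      ; surjective = λ x vertex → vertex-elementaryRoute x vertex ℛ
      }

    rays : BijectionUpTo (SelfCompatibleElementaryBand G ℛ) (RotEq G)
             (IsExtremalRay G (RecCone𝓕₁ G)) (PosMultiple G) (𝓘 G)
    rays = record
      { maps-to    = λ b band → simpleCycle-extremalRay b (band⇒simpleCycle ℛ b band)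
      ; injective  = λ b b' band band' →
                       simpleCycle-injective b b' (band⇒simpleCycle ℛ b band) (band⇒simpleCycle ℛ b' band')
      ; surjective = λ r ray → let b , cycle , b∝r = extremalRay-simpleCycle r ray in
                       b , simpleCycle⇒band ℛ b cycle , b∝r
      }
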